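{- Let $v\ge 7$. An $\mathrm{STS}_2(v)$ on $\mathbb{F}_2^v$ does not have an automorphism of order $3$ of type $A_{v,f}$ with $f>(v-3)/2$ and $f\not\equiv v\pmod 3$.
   Context: An $\mathrm{STS}_2(v)$ on $V=\mathbb{F}_2^v$ is a set of $3$-dimensional subspaces (blocks) of $V$ such that every $2$-dimensional subspace lies in exactly one block. $\mathrm{GL}(v,2)$ acts on subspaces via $\mathbf{x}\mapsto\mathbf{x}A$; an automorphism of $D$ is an $A\in\mathrm{GL}(v,2)$ mapping $D$ to itself. For $f\in\{0,\ldots,v-1\}$ with $v-f$ even, $A_{v,f}$ is the block-diagonal matrix consisting of $\frac{v-f}{2}$ blocks $\begin{pmatrix}0&1\\1&1\end{pmatrix}$ followed by $I_f$; every element of order $3$ in $\mathrm{GL}(v,2)$ is conjugate to exactly one $A_{v,f}$, called its type. -}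

module Defs where

open import Data.Bool using (Bool; true; false; _∧_; _∨_; not; _xor_; if_then_else_)
open import Data.Nat using (ℕ; zero; suc; _+_; _*_; _∸_; _<ᵇ_; _≡ᵇ_; _/_; _%_)
open import Data.Fin using (Fin; toℕ)
open import Data.Vec using (Vec; []; _∷_; zipWith; replicate; map; tabulate)
open import Data.Bool.ListAction using (any)
open import Data.List using (List) renaming ([] to []ᴸ; _∷_ to _∷ᴸ_; map to mapᴸ; _++_ to _++ᴸ_)
open import Data.Product using (Σ; _×_; _,_)
open import Relation.Binary.PropositionalEquality using (_≡_; _≢_)

-- Vectors of F₂^v are Vec Bool v (true = 1, false = 0).
F2 : ℕ → Set
F2 v = Vec Bool v

zeroV : ∀ {v} → F2 v
zeroV = replicate _ false

_⊕_ : ∀ {v} → F2 v → F2 v → F2 v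
_⊕_ = zipWith _xor_

eqV : ∀ {v} → F2 v → F2 v → Bool
eqV [] [] = true
eqV (x ∷ xs) (y ∷ ys) = not (x xor y) ∧ eqV xs ys

allVecs : (n : ℕ) → List (F2 n)
allVecs zero = [] ∷ᴸ []ᴸ
allVecs (suc n) = mapᴸ (false ∷_) (allVecs n) ++ᴸ mapᴸ (true ∷_) (allVecs n)

-- A k × v matrix over F₂, given as its k rows.
Mat : ℕ → ℕ → Set
Mat k v = Vec (F2 v) k

-- row vector times matrix: x ↦ x B  (= Σ x_i · row_i)
_·_ : ∀ {k v} → F2 k → Mat k v → F2 v
[] · [] = zeroV
(false ∷ x) · (r ∷ B) = x · B
(true ∷ x) · (r ∷ B) = r ⊕ (x · B)

SqMat : ℕ → Set
SqMat v = Mat v v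

_⊗_ : ∀ {k l v} → Mat k l → Mat l v → Mat k v
A ⊗ B = map (λ row → row · B) A

Id : ∀ {v} → SqMat v
Id = tabulate λ i → tabulate λ j → toℕ i ≡ᵇ toℕ j

Invertible : ∀ {v} → SqMat v → Set
Invertible {v} A = Σ (SqMat v) λ B → (A ⊗ B ≡ Id) × (B ⊗ A ≡ Id)

-- Subsets of F₂^v, represented canonically as a binary decision tree
-- (so that equality of subsets is propositional equality).
Sub : ℕ → Set
Sub zero = Bool
Sub (suc n) = Sub n × Sub n

_∈?_ : ∀ {v} → F2 v → Sub v → Bool
_∈?_ [] b = b
_∈?_ (false ∷ x) (s₀ , s₁) = x ∈? s₀
_∈?_ (true ∷ x) (s₀ , s₁) = x ∈? s₁

tab : ∀ {v} → (F2 v → Bool) → Sub v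
tab {zero} f = f []
tab {suc v} f = tab (λ x → f (false ∷ x)) , tab (λ x → f (true ∷ x))

_⊆_ : ∀ {v} → Sub v → Sub v → Set
S ⊆ T = ∀ x → x ∈? S ≡ true → x ∈? T ≡ true

span : ∀ {k v} → Mat k v → Sub v
span {k} B = tab λ y → any (λ c → eqV (c · B) y) (allVecs k)

Independent : ∀ {k v} → Mat k v → Set
Independent {k} B = ∀ (c : F2 k) → c · B ≡ zeroV → c ≡ zeroV

IsSubspaceDim : ∀ {v} → ℕ → Sub v → Set
IsSubspaceDim {v} k S = Σ (Mat k v) λ B → Independent B × (span B ≡ S)

-- STS₂(v): a set D of 3-dimensional subspaces (blocks), given by its characteristic
-- function on subsets of F₂^v, such that every 2-dim subspace lies in exactly one block.
IsSTS2 : (v : ℕ) → (Sub v → Bool) → Set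
IsSTS2 v D =
  (∀ B → D B ≡ true → IsSubspaceDim 3 B) ×
  (∀ T → IsSubspaceDim 2 T →
     Σ (Sub v) λ B → (D B ≡ true) × (T ⊆ B) ×
       (∀ B' → D B' ≡ true → T ⊆ B' → B' ≡ B))

image : ∀ {v} → SqMat v → Sub v → Sub v
image {v} A S = tab λ y → any (λ x → (x ∈? S) ∧ eqV (x · A) y) (allVecs v)

IsAutomorphism : ∀ {v} → (Sub v → Bool) → SqMat v → Set
IsAutomorphism D A = Invertible A × (∀ B → D (image A B) ≡ D B)

HasOrder3 : ∀ {v} → SqMat v → Set
HasOrder3 A = (A ⊗ (A ⊗ A) ≡ Id) × (A ≢ Id)

-- A_{v,f}: (v-f)/2 diagonal blocks [[0,1],[1,1]] followed by I_f
-- (intended for v - f even).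
Avf : (v f : ℕ) → SqMat v
Avf v f = tabulate λ i → tabulate λ j → entry (toℕ i) (toℕ j)
  where
    n = v ∸ f
    entry : ℕ → ℕ → Bool
    entry i j =
      if (i <ᵇ n) ∧ (j <ᵇ n)
        then ((i / 2) ≡ᵇ (j / 2)) ∧ not (((i % 2) ≡ᵇ 0) ∧ ((j % 2) ≡ᵇ 0))
        else (if (i <ᵇ n) ∨ (j <ᵇ n) then false else (i ≡ᵇ j))

-- A is of type A_{v,f}: A is conjugate in GL(v,2) to A_{v,f}
-- (A = P A_{v,f} P⁻¹, i.e. A P = P A_{v,f} with P invertible).
HasType : ∀ {v} → SqMat v → ℕ → Set
HasType {v} A f = Σ (SqMat v) λ P → Invertible P × (A ⊗ P ≡ P ⊗ Avf v f)

module Submission where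

-- Write W for the fixed space of the automorphism α, of size 2 ^ f, and U for the kernel of
-- α² + α + 1, of size 4 ^ m where v = 2m + f.  For nonzero w ∈ W, a block through w and a moved
-- point meets W only in {0, w}, so the blocks through w cut the moved points into sixes.  If none
-- of them were α-invariant they would come in α-orbits of three, so 18 would divide
-- 2 ^ f (4 ^ m - 1), forcing 3 ∣ m and v ≡ f (mod 3).  Hence every nonzero w ∈ W lies in an
-- invariant block, which contains three nonzero points of U, and distinct w give disjoint
-- triples; so 3 (2 ^ f - 1) ≤ 4 ^ m - 1.  Since 6 divides 2 ^ v - 2 the exponent f is odd, and
-- with v < 2f + 3 this inequality leaves only v ≤ 3.

open import Defs
open import Data.Bool using (Bool; true; false; not; _∧_; _∨_; _xor_; if_then_else_)
open import Data.Bool.ListAction using (any)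
import Data.Bool.Properties as Boolₚ
open import Data.Empty using (⊥; ⊥-elim)
open import Data.Fin using (Fin; toℕ)
open import Data.List using (List) renaming ([] to []ᴸ; _∷_ to _∷ᴸ_; _++_ to _++ᴸ_; map to mapᴸ)
open import Data.Nat using (ℕ; zero; suc; NonZero; >-nonZero⁻¹; _≤_; _<_; _+_; _*_; _∸_; _/_; _%_; _^_;
                            z≤n; s≤s; _≡ᵇ_; _<ᵇ_; _≤?_)
open import Data.Nat.DivMod using (m≡m%n+[m/n]*n; m%n<n; m/n≡1+[m∸n]/n; [m+n]%n≡m%n; [m+kn]%n≡m%n;
                                   %-distribˡ-*; %-distribˡ-+; m%n%n≡m%n)
open import Data.Nat.Divisibility using (_∣_; divides; _∣0; ∣m∣n⇒∣m+n; n∣n; ∣-trans; *-cancelˡ-∣;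
                                         m%n≡0⇒n∣m; n∣m⇒m%n≡0; ∣⇒≤)
open import Data.Nat.Primality using (Prime; prime?; euclidsLemma)
open import Data.Nat.Properties
open import Data.Nat.Tactic.RingSolver using (solve-∀)
open import Data.Product using (Σ; _×_; _,_; proj₁; proj₂)
open import Data.Sum using (_⊎_; inj₁; inj₂)
open import Data.Vec as Vec using (Vec; []; _∷_)
import Data.Vec.Properties as Vecₚ
open import Function using (_$_)
open import Relation.Binary.PropositionalEquality
open import Relation.Nullary using (¬_; Dec; yes; no; ¬?; _×-dec_)
open import Relation.Nullary.Decidable using (from-yes)

-- Vectors and matrices over F₂

⊕-assoc : ∀ {n} (x y z : F2 n) → (x ⊕ y) ⊕ z ≡ x ⊕ (y ⊕ z)
⊕-assoc = Vecₚ.zipWith-assoc Boolₚ.xor-assoc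

⊕-identityˡ : ∀ {n} (x : F2 n) → zeroV ⊕ x ≡ x
⊕-identityˡ = Vecₚ.zipWith-identityˡ Boolₚ.xor-identityˡ

⊕-identityʳ : ∀ {n} (x : F2 n) → x ⊕ zeroV ≡ x
⊕-identityʳ = Vecₚ.zipWith-identityʳ Boolₚ.xor-identityʳ

⊕-comm : ∀ {n} (x y : F2 n) → x ⊕ y ≡ y ⊕ x
⊕-comm [] [] = refl
⊕-comm (a ∷ x) (b ∷ y) = cong₂ _∷_ (Boolₚ.xor-comm a b) (⊕-comm x y)

⊕-self : ∀ {n} (x : F2 n) → x ⊕ x ≡ zeroV
⊕-self [] = refl
⊕-self (a ∷ x) = cong₂ _∷_ (Boolₚ.xor-same a) (⊕-self x)

⊕-cancelˡ : ∀ {n} (x y : F2 n) → x ⊕ (x ⊕ y) ≡ y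
⊕-cancelˡ x y = begin
  x ⊕ (x ⊕ y)  ≡⟨ ⊕-assoc x x y ⟨
  (x ⊕ x) ⊕ y  ≡⟨ cong (_⊕ y) (⊕-self x) ⟩
  zeroV ⊕ y    ≡⟨ ⊕-identityˡ y ⟩
  y            ∎
  where open ≡-Reasoning

⊕-cancelʳ : ∀ {n} (x y : F2 n) → (x ⊕ y) ⊕ y ≡ x
⊕-cancelʳ x y = trans (⊕-comm (x ⊕ y) y) (trans (cong (y ⊕_) (⊕-comm x y)) (⊕-cancelˡ y x))

⊕-interchange : ∀ {n} (a b c d : F2 n) → (a ⊕ b) ⊕ (c ⊕ d) ≡ (a ⊕ c) ⊕ (b ⊕ d)
⊕-interchange a b c d = begin
  (a ⊕ b) ⊕ (c ⊕ d)  ≡⟨ ⊕-assoc a b (c ⊕ d) ⟩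
  a ⊕ (b ⊕ (c ⊕ d))  ≡⟨ cong (a ⊕_) (⊕-assoc b c d) ⟨
  a ⊕ ((b ⊕ c) ⊕ d)  ≡⟨ cong (λ t → a ⊕ (t ⊕ d)) (⊕-comm b c) ⟩
  a ⊕ ((c ⊕ b) ⊕ d)  ≡⟨ cong (a ⊕_) (⊕-assoc c b d) ⟩
  a ⊕ (c ⊕ (b ⊕ d))  ≡⟨ ⊕-assoc a c (b ⊕ d) ⟨
  (a ⊕ c) ⊕ (b ⊕ d)  ∎
  where open ≡-Reasoning

⊕≡zero⇒≡ : ∀ {n} {x y : F2 n} → x ⊕ y ≡ zeroV → x ≡ y
⊕≡zero⇒≡ {x = x} {y} e = trans (sym (⊕-cancelʳ x y)) (trans (cong (_⊕ y) e) (⊕-identityˡ y))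

eqV-refl : ∀ {n} (x : F2 n) → eqV x x ≡ true
eqV-refl [] = refl
eqV-refl (false ∷ x) = eqV-refl x
eqV-refl (true ∷ x) = eqV-refl x

eqV-sound : ∀ {n} {x y : F2 n} → eqV x y ≡ true → x ≡ y
eqV-sound {x = []} {[]} _ = refl
eqV-sound {x = false ∷ x} {false ∷ y} e = cong (false ∷_) (eqV-sound e)
eqV-sound {x = true ∷ x} {true ∷ y} e = cong (true ∷_) (eqV-sound e)
eqV-sound {x = false ∷ _} {true ∷ _} ()
eqV-sound {x = true ∷ _} {false ∷ _} ()

eqV-complete : ∀ {n} {x y : F2 n} → x ≡ y → eqV x y ≡ true
eqV-complete {x = x} refl = eqV-refl x

eqV-≢ : ∀ {n} {x y : F2 n} → x ≢ y → eqV x y ≡ false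
eqV-≢ {x = x} {y} x≢y with eqV x y in e
... | true = ⊥-elim (x≢y (eqV-sound e))
... | false = refl

_≟ᵥ_ : ∀ {n} (x y : F2 n) → Dec (x ≡ y)
_≟ᵥ_ = Vecₚ.≡-dec Boolₚ._≟_

·-zeroˡ : ∀ {k n} (M : Mat k n) → zeroV · M ≡ zeroV
·-zeroˡ [] = refl
·-zeroˡ (r ∷ M) = ·-zeroˡ M

·-distrib-⊕ : ∀ {k n} (x y : F2 k) (M : Mat k n) → (x ⊕ y) · M ≡ (x · M) ⊕ (y · M)
·-distrib-⊕ [] [] [] = sym (⊕-self zeroV)
·-distrib-⊕ (false ∷ x) (false ∷ y) (r ∷ M) = ·-distrib-⊕ x y M
·-distrib-⊕ (false ∷ x) (true ∷ y) (r ∷ M) = begin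
  r ⊕ ((x ⊕ y) · M)          ≡⟨ cong (r ⊕_) (·-distrib-⊕ x y M) ⟩
  r ⊕ ((x · M) ⊕ (y · M))    ≡⟨ ⊕-assoc r _ _ ⟨
  (r ⊕ (x · M)) ⊕ (y · M)    ≡⟨ cong (_⊕ (y · M)) (⊕-comm r _) ⟩
  ((x · M) ⊕ r) ⊕ (y · M)    ≡⟨ ⊕-assoc _ r _ ⟩
  (x · M) ⊕ (r ⊕ (y · M))    ∎
  where open ≡-Reasoning
·-distrib-⊕ (true ∷ x) (false ∷ y) (r ∷ M) =
  trans (cong (r ⊕_) (·-distrib-⊕ x y M)) (sym (⊕-assoc r _ _))
·-distrib-⊕ (true ∷ x) (true ∷ y) (r ∷ M) = begin
  (x ⊕ y) · M                          ≡⟨ ·-distrib-⊕ x y M ⟩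
  (x · M) ⊕ (y · M)                    ≡⟨ ⊕-identityˡ _ ⟨
  zeroV ⊕ ((x · M) ⊕ (y · M))          ≡⟨ cong (_⊕ _) (⊕-self r) ⟨
  (r ⊕ r) ⊕ ((x · M) ⊕ (y · M))        ≡⟨ ⊕-interchange r r _ _ ⟩
  (r ⊕ (x · M)) ⊕ (r ⊕ (y · M))        ∎
  where open ≡-Reasoning

·-⊗ : ∀ {k l n} (x : F2 k) (M : Mat k l) (N : Mat l n) → x · (M ⊗ N) ≡ (x · M) · N
·-⊗ [] [] N = sym (·-zeroˡ N)
·-⊗ (false ∷ x) (r ∷ M) N = ·-⊗ x M N
·-⊗ (true ∷ x) (r ∷ M) N = trans (cong ((r · N) ⊕_) (·-⊗ x M N)) (sym (·-distrib-⊕ r (x · M) N))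

·-map-false∷ : ∀ {k n} (x : F2 k) (M : Mat k n) → x · Vec.map (false ∷_) M ≡ false ∷ (x · M)
·-map-false∷ [] [] = refl
·-map-false∷ (false ∷ x) (r ∷ M) = ·-map-false∷ x M
·-map-false∷ (true ∷ x) (r ∷ M) = cong ((false ∷ r) ⊕_) (·-map-false∷ x M)

Id-suc : ∀ {n} → Id {suc n} ≡ (true ∷ zeroV) ∷ Vec.map (false ∷_) (Id {n})
Id-suc {n} = cong₂ _∷_ (cong (true ∷_) (first-row n)) (Vecₚ.tabulate-∘ (false ∷_) _)
  where
  first-row : ∀ m → Vec.tabulate {n = m} (λ j → zero ≡ᵇ suc (toℕ j)) ≡ zeroV
  first-row zero = refl
  first-row (suc m) = cong (false ∷_) (first-row m)

·-Id : ∀ {n} (x : F2 n) → x · Id ≡ x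
·-Id [] = refl
·-Id {suc n} (false ∷ x) = begin
  (false ∷ x) · Id                          ≡⟨ cong ((false ∷ x) ·_) Id-suc ⟩
  x · Vec.map (false ∷_) Id                 ≡⟨ ·-map-false∷ x Id ⟩
  false ∷ (x · Id)                          ≡⟨ cong (false ∷_) (·-Id x) ⟩
  false ∷ x                                 ∎
  where open ≡-Reasoning
·-Id {suc n} (true ∷ x) = begin
  (true ∷ x) · Id                           ≡⟨ cong ((true ∷ x) ·_) Id-suc ⟩
  (true ∷ zeroV) ⊕ (x · Vec.map (false ∷_) Id)  ≡⟨ cong ((true ∷ zeroV) ⊕_) (·-map-false∷ x Id) ⟩
  true ∷ (zeroV ⊕ (x · Id))                 ≡⟨ cong (true ∷_) (trans (⊕-identityˡ _) (·-Id x)) ⟩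
  true ∷ x                                  ∎
  where open ≡-Reasoning

-- Finite search, sums and counting over F₂ⁿ

∨-introˡ : ∀ {a b} → a ≡ true → a ∨ b ≡ true
∨-introˡ refl = refl

∨-introʳ : ∀ a {b} → b ≡ true → a ∨ b ≡ true
∨-introʳ a refl = Boolₚ.∨-zeroʳ a

∃ᵇ : (n : ℕ) → (F2 n → Bool) → Bool
∃ᵇ zero p = p []
∃ᵇ (suc n) p = ∃ᵇ n (λ x → p (false ∷ x)) ∨ ∃ᵇ n (λ x → p (true ∷ x))

any-allVecs : ∀ n (p : F2 n → Bool) → any p (allVecs n) ≡ ∃ᵇ n p
any-allVecs zero p = Boolₚ.∨-identityʳ (p [])
any-allVecs (suc n) p = begin
  any p (mapᴸ (false ∷_) (allVecs n) ++ᴸ mapᴸ (true ∷_) (allVecs n))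
    ≡⟨ any-++ (mapᴸ (false ∷_) (allVecs n)) ⟩
  any p (mapᴸ (false ∷_) (allVecs n)) ∨ any p (mapᴸ (true ∷_) (allVecs n))
    ≡⟨ cong₂ _∨_ (trans (any-map (false ∷_) (allVecs n)) (any-allVecs n _))
                 (trans (any-map (true ∷_) (allVecs n)) (any-allVecs n _)) ⟩
  ∃ᵇ (suc n) p
    ∎
  where
  open ≡-Reasoning
  any-++ : ∀ {A : Set} {q : A → Bool} (xs : List A) {ys} → any q (xs ++ᴸ ys) ≡ any q xs ∨ any q ys
  any-++ []ᴸ = refl
  any-++ {q = q} (x ∷ᴸ xs) = trans (cong (q x ∨_) (any-++ xs)) (sym (Boolₚ.∨-assoc (q x) _ _))
  any-map : ∀ {A B : Set} {q : B → Bool} (g : A → B) (xs : List A) →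
            any q (mapᴸ g xs) ≡ any (λ x → q (g x)) xs
  any-map g []ᴸ = refl
  any-map {q = q} g (x ∷ᴸ xs) = cong (q (g x) ∨_) (any-map g xs)

∃ᵇ-intro : ∀ {n} (p : F2 n → Bool) (x : F2 n) → p x ≡ true → ∃ᵇ n p ≡ true
∃ᵇ-intro p [] px = px
∃ᵇ-intro {suc n} p (false ∷ x) px =
  cong (_∨ ∃ᵇ n (λ x → p (true ∷ x))) (∃ᵇ-intro (λ x → p (false ∷ x)) x px)
∃ᵇ-intro {suc n} p (true ∷ x) px =
  trans (cong (∃ᵇ n (λ x → p (false ∷ x)) ∨_) (∃ᵇ-intro (λ x → p (true ∷ x)) x px))
        (Boolₚ.∨-zeroʳ _)

∃ᵇ-none : ∀ {n} (p : F2 n → Bool) → (∀ x → p x ≡ false) → ∃ᵇ n p ≡ false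
∃ᵇ-none {zero} p none = none []
∃ᵇ-none {suc n} p none =
  cong₂ _∨_ (∃ᵇ-none _ (λ x → none (false ∷ x))) (∃ᵇ-none _ (λ x → none (true ∷ x)))

search : ∀ n (p : F2 n → Bool) → (Σ (F2 n) λ x → p x ≡ true) ⊎ (∀ x → p x ≡ false)
search zero p with p [] in e
... | true = inj₁ ([] , e)
... | false = inj₂ λ { [] → e }
search (suc n) p with search n (λ x → p (false ∷ x)) | search n (λ x → p (true ∷ x))
... | inj₁ (x , px) | _ = inj₁ (false ∷ x , px)
... | inj₂ _ | inj₁ (x , px) = inj₁ (true ∷ x , px)
... | inj₂ none₀ | inj₂ none₁ = inj₂ λ { (false ∷ x) → none₀ x ; (true ∷ x) → none₁ x }

∃ᵇ-elim : ∀ {n} (p : F2 n → Bool) → ∃ᵇ n p ≡ true → Σ (F2 n) λ x → p x ≡ true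
∃ᵇ-elim {n} p ∃p with search n p
... | inj₁ witness = witness
... | inj₂ none with trans (sym ∃p) (∃ᵇ-none p none)
...   | ()

∑ : (n : ℕ) → (F2 n → ℕ) → ℕ
∑ zero g = g []
∑ (suc n) g = ∑ n (λ x → g (false ∷ x)) + ∑ n (λ x → g (true ∷ x))

∑-cong : ∀ {n} {g h : F2 n → ℕ} → (∀ x → g x ≡ h x) → ∑ n g ≡ ∑ n h
∑-cong {zero} g≗h = g≗h []
∑-cong {suc n} g≗h = cong₂ _+_ (∑-cong (λ x → g≗h (false ∷ x))) (∑-cong (λ x → g≗h (true ∷ x)))

∑-mono-≤ : ∀ {n} {g h : F2 n → ℕ} → (∀ x → g x ≤ h x) → ∑ n g ≤ ∑ n h
∑-mono-≤ {zero} g≤h = g≤h []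
∑-mono-≤ {suc n} g≤h = +-mono-≤ (∑-mono-≤ (λ x → g≤h (false ∷ x))) (∑-mono-≤ (λ x → g≤h (true ∷ x)))

∑-zero : ∀ {n} {g : F2 n → ℕ} → (∀ x → g x ≡ 0) → ∑ n g ≡ 0
∑-zero {zero} g≡0 = g≡0 []
∑-zero {suc n} g≡0 = cong₂ _+_ (∑-zero (λ x → g≡0 (false ∷ x))) (∑-zero (λ x → g≡0 (true ∷ x)))

∑-one : ∀ n → ∑ n (λ _ → 1) ≡ 2 ^ n
∑-one zero = refl
∑-one (suc n) = trans (cong₂ _+_ (∑-one n) (∑-one n)) (cong (2 ^ n +_) (sym (+-identityʳ (2 ^ n))))

∑-distrib-+ : ∀ n (g h : F2 n → ℕ) → ∑ n (λ x → g x + h x) ≡ ∑ n g + ∑ n h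
∑-distrib-+ zero g h = refl
∑-distrib-+ (suc n) g h = trans
  (cong₂ _+_ (∑-distrib-+ n (λ x → g (false ∷ x)) (λ x → h (false ∷ x)))
             (∑-distrib-+ n (λ x → g (true ∷ x)) (λ x → h (true ∷ x))))
  (+-+-interchange (∑ n (λ x → g (false ∷ x))) (∑ n (λ x → h (false ∷ x)))
                   (∑ n (λ x → g (true ∷ x))) (∑ n (λ x → h (true ∷ x))))
  where
  +-+-interchange : ∀ a b c d → (a + b) + (c + d) ≡ (a + c) + (b + d)
  +-+-interchange = solve-∀

∑-distribˡ-* : ∀ n k (g : F2 n → ℕ) → ∑ n (λ x → k * g x) ≡ k * ∑ n g
∑-distribˡ-* zero k g = refl
∑-distribˡ-* (suc n) k g =
  trans (cong₂ _+_ (∑-distribˡ-* n k _) (∑-distribˡ-* n k _)) (sym (*-distribˡ-+ k _ _))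

∑-comm : ∀ n k (g : F2 n → F2 k → ℕ) → ∑ n (λ x → ∑ k (g x)) ≡ ∑ k (λ y → ∑ n (λ x → g x y))
∑-comm zero k g = refl
∑-comm (suc n) k g = trans (cong₂ _+_ (∑-comm n k _) (∑-comm n k _)) (sym (∑-distrib-+ k _ _))

∑-delta : ∀ {n} (a : F2 n) (h : F2 n → ℕ) → ∑ n (λ y → if eqV y a then h y else 0) ≡ h a
∑-delta [] h = refl
∑-delta {suc n} (false ∷ a) h =
  trans (cong₂ _+_ (∑-delta a (λ y → h (false ∷ y))) (∑-zero {n} (λ _ → refl))) (+-identityʳ _)
∑-delta {suc n} (true ∷ a) h =
  trans (cong (_+ ∑ n (λ y → if eqV y a then h (true ∷ y) else 0)) (∑-zero {n} (λ _ → refl)))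
        (∑-delta a (λ y → h (true ∷ y)))

-- Reindexing: expand g (φ x) as a sum over y of [y = φ x] g y and swap the two sums.
∑-reindex : ∀ {n} (φ ψ : F2 n → F2 n) → (∀ x → ψ (φ x) ≡ x) → (∀ y → φ (ψ y) ≡ y) →
            (g : F2 n → ℕ) → ∑ n (λ x → g (φ x)) ≡ ∑ n g
∑-reindex {n} φ ψ ψφ φψ g = begin
  ∑ n (λ x → g (φ x))
    ≡⟨ ∑-cong (λ x → ∑-delta (φ x) g) ⟨
  ∑ n (λ x → ∑ n (λ y → if eqV y (φ x) then g y else 0))
    ≡⟨ ∑-comm n n _ ⟩
  ∑ n (λ y → ∑ n (λ x → if eqV y (φ x) then g y else 0))
    ≡⟨ ∑-cong (λ y → ∑-cong (λ x → cong (λ b → if b then g y else 0) (swap-eq x y))) ⟩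
  ∑ n (λ y → ∑ n (λ x → if eqV x (ψ y) then g y else 0))
    ≡⟨ ∑-cong (λ y → ∑-delta (ψ y) (λ _ → g y)) ⟩
  ∑ n g
    ∎
  where
  open ≡-Reasoning
  swap-eq : ∀ x y → eqV y (φ x) ≡ eqV x (ψ y)
  swap-eq x y with eqV y (φ x) in e₁ | eqV x (ψ y) in e₂
  ... | true | true = refl
  ... | false | false = refl
  ... | true | false = sym (trans (sym e₂) (eqV-complete (trans (sym (ψφ x)) (cong ψ (sym (eqV-sound e₁))))))
  ... | false | true = trans (sym e₁) (eqV-complete (trans (sym (φψ y)) (cong φ (sym (eqV-sound e₂)))))

𝟙 : Bool → ℕ
𝟙 true = 1
𝟙 false = 0

count : (n : ℕ) → (F2 n → Bool) → ℕ
count n p = ∑ n (λ x → 𝟙 (p x))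

count-cong : ∀ {n} {p q : F2 n → Bool} → (∀ x → p x ≡ q x) → count n p ≡ count n q
count-cong p≗q = ∑-cong (λ x → cong 𝟙 (p≗q x))

count-none : ∀ {n} {p : F2 n → Bool} → (∀ x → p x ≡ false) → count n p ≡ 0
count-none none = ∑-zero (λ x → cong 𝟙 (none x))

count-≤-2^ : ∀ n (p : F2 n → Bool) → count n p ≤ 2 ^ n
count-≤-2^ n p = ≤-trans (∑-mono-≤ (λ x → 𝟙≤1 (p x))) (≤-reflexive (∑-one n))
  where
  𝟙≤1 : ∀ b → 𝟙 b ≤ 1
  𝟙≤1 true = ≤-refl
  𝟙≤1 false = z≤n

count-singleton : ∀ {n} (a : F2 n) → count n (λ z → eqV z a) ≡ 1
count-singleton {n} a = trans (∑-cong (λ z → 𝟙-if (eqV z a))) (∑-delta a (λ _ → 1))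
  where
  𝟙-if : ∀ b → 𝟙 b ≡ (if b then 1 else 0)
  𝟙-if true = refl
  𝟙-if false = refl

count-unique : ∀ {n} {p : F2 n → Bool} (a : F2 n) → p a ≡ true → (∀ b → p b ≡ true → b ≡ a) →
               count n p ≡ 1
count-unique {p = p} a pa unique = trans (count-cong p≗[a]) (count-singleton a)
  where
  p≗[a] : ∀ z → p z ≡ eqV z a
  p≗[a] z with p z in pz | eqV z a in z≟a
  ... | true | true = refl
  ... | false | false = refl
  ... | true | false = trans (sym (eqV-complete (unique z pz))) z≟a
  ... | false | true = trans (sym pz) (subst (λ t → p t ≡ true) (sym (eqV-sound z≟a)) pa)

count-≤1 : ∀ {n} (p : F2 n → Bool) → (∀ a b → p a ≡ true → p b ≡ true → a ≡ b) → count n p ≤ 1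
count-≤1 {n} p unique with search n p
... | inj₁ (a , pa) = ≤-reflexive (count-unique a pa (λ b pb → unique b a pb pa))
... | inj₂ none = ≤-trans (≤-reflexive (count-none none)) z≤n

𝟙-∃ᵇ : ∀ {n} (p : F2 n → Bool) → (∀ a b → p a ≡ true → p b ≡ true → a ≡ b) → 𝟙 (∃ᵇ n p) ≡ count n p
𝟙-∃ᵇ {n} p unique with search n p
... | inj₁ (a , pa) =
  trans (cong 𝟙 (∃ᵇ-intro p a pa)) (sym (count-unique a pa (λ b pb → unique b a pb pa)))
... | inj₂ none = trans (cong 𝟙 (∃ᵇ-none p none)) (sym (count-none none))

count-split : ∀ {n} (p q : F2 n → Bool) →
              count n p ≡ count n (λ z → p z ∧ q z) + count n (λ z → p z ∧ not (q z))
count-split {n} p q = trans (∑-cong (λ z → 𝟙-split (p z) (q z))) (∑-distrib-+ n _ _)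
  where
  𝟙-split : ∀ a b → 𝟙 a ≡ 𝟙 (a ∧ b) + 𝟙 (a ∧ not b)
  𝟙-split false b = refl
  𝟙-split true false = refl
  𝟙-split true true = refl

count-remove : ∀ {n} (p : F2 n → Bool) (a : F2 n) → p a ≡ true →
               count n p ≡ count n (λ z → p z ∧ not (eqV z a)) + 1
count-remove {n} p a pa =
  trans (count-split p (λ z → not (eqV z a))) (cong (count n (λ z → p z ∧ not (eqV z a)) +_) only-a)
  where
  only-a : count n (λ z → p z ∧ not (not (eqV z a))) ≡ 1
  only-a = count-unique a
    (trans (cong (λ b → p a ∧ not (not b)) (eqV-refl a)) (trans (Boolₚ.∧-identityʳ (p a)) pa))
    (λ b pb → eqV-sound (trans (sym (Boolₚ.not-involutive _)) (Boolₚ.∧-conicalʳ _ _ pb)))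

count-mono : ∀ {n} {p q : F2 n → Bool} → (∀ z → p z ≡ true → q z ≡ true) → count n p ≤ count n q
count-mono {n} {p} {q} p⊆q = ∑-mono-≤ (λ z → 𝟙-mono (p z) (q z) (p⊆q z))
  where
  𝟙-mono : ∀ a b → (a ≡ true → b ≡ true) → 𝟙 a ≤ 𝟙 b
  𝟙-mono false b _ = z≤n
  𝟙-mono true b a⇒b rewrite a⇒b refl = ≤-refl

count-∨ : ∀ {n} (p q : F2 n → Bool) → (∀ z → p z ≡ true → q z ≡ true → ⊥) →
          count n (λ z → p z ∨ q z) ≡ count n p + count n q
count-∨ {n} p q p#q = trans (∑-cong (λ z → 𝟙-∨ (p z) (q z) (p#q z))) (∑-distrib-+ n _ _)
  where
  𝟙-∨ : ∀ a b → (a ≡ true → b ≡ true → ⊥) → 𝟙 (a ∨ b) ≡ 𝟙 a + 𝟙 b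
  𝟙-∨ false b _ = refl
  𝟙-∨ true false _ = refl
  𝟙-∨ true true a#b = ⊥-elim (a#b refl refl)

-- Removing the class of one point leaves a predicate with the same two properties, which
-- drives an induction bounded by the size 2 ^ n of the ambient space.
count-classes : ∀ {n} k .{{_ : NonZero k}} (s : F2 n → Bool) (R : F2 n → F2 n → Bool) →
                (∀ y → s y ≡ true → count n (λ z → s z ∧ R y z) ≡ k) →
                (∀ y z u → s y ≡ true → s z ≡ true → s u ≡ true →
                   R y u ≡ true → R z u ≡ true → R y z ≡ true) →
                k ∣ count n s
count-classes {n} k s R = by-bound (2 ^ n) s (count-≤-2^ n s)
  where
  ClassesOfSize : (F2 n → Bool) → Set
  ClassesOfSize s = ∀ y → s y ≡ true → count n (λ z → s z ∧ R y z) ≡ k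

  Euclidean : (F2 n → Bool) → Set
  Euclidean s = ∀ y z u → s y ≡ true → s z ≡ true → s u ≡ true →
                R y u ≡ true → R z u ≡ true → R y z ≡ true

  by-bound : ∀ b s → count n s ≤ b → ClassesOfSize s → Euclidean s → k ∣ count n s
  by-bound b s bound size euclid with search n s
  ... | inj₂ none = subst (k ∣_) (sym (count-none none)) (k ∣0)
  ... | inj₁ (y , sy) = subst (k ∣_) (sym split) (∣m∣n⇒∣m+n n∣n (divides-rest b (subst (_≤ b) split bound)))
    where
    s′ : F2 n → Bool
    s′ z = s z ∧ not (R y z)

    split : count n s ≡ k + count n s′
    split = trans (count-split s (R y)) (cong (_+ count n s′) (size y sy))

    s′∧R≗s∧R : ∀ z → s z ≡ true → R y z ≡ false → ∀ u → s′ u ∧ R z u ≡ s u ∧ R z u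
    s′∧R≗s∧R z sz ¬Ryz u with s u in su | R z u in Rzu | R y u in Ryu
    ... | false | _ | _ = refl
    ... | true | false | _ = Boolₚ.∧-zeroʳ _
    ... | true | true | false = refl
    ... | true | true | true with trans (sym (euclid y z u sy sz su Ryu Rzu)) ¬Ryz
    ...   | ()

    s′⇒s : ∀ {z} → s′ z ≡ true → s z ≡ true
    s′⇒s {z} s′z = Boolₚ.∧-conicalˡ (s z) _ s′z

    s′⇒¬R : ∀ {z} → s′ z ≡ true → R y z ≡ false
    s′⇒¬R {z} s′z = Boolₚ.not-injective (Boolₚ.∧-conicalʳ (s z) _ s′z)

    size′ : ClassesOfSize s′
    size′ z s′z = trans (count-cong (s′∧R≗s∧R z (s′⇒s s′z) (s′⇒¬R s′z))) (size z (s′⇒s s′z))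

    euclid′ : Euclidean s′
    euclid′ y z u s′y s′z s′u = euclid y z u (s′⇒s s′y) (s′⇒s s′z) (s′⇒s s′u)

    divides-rest : ∀ b → k + count n s′ ≤ b → k ∣ count n s′
    divides-rest zero k+c≤0 = ⊥-elim (<⇒≱ (>-nonZero⁻¹ k) (≤-trans (m≤m+n k _) k+c≤0))
    divides-rest (suc b) k+c≤1+b =
      by-bound b s′ (+-cancelˡ-≤ 1 _ _ (≤-trans (+-monoˡ-≤ _ (>-nonZero⁻¹ k)) k+c≤1+b)) size′ euclid′

-- Subspaces

∈?-tab : ∀ {n} (g : F2 n → Bool) (x : F2 n) → x ∈? tab g ≡ g x
∈?-tab g [] = refl
∈?-tab g (false ∷ x) = ∈?-tab _ x
∈?-tab g (true ∷ x) = ∈?-tab _ x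

∈span-intro : ∀ {k n} (M : Mat k n) (c : F2 k) {y : F2 n} → c · M ≡ y → y ∈? span M ≡ true
∈span-intro {k} M c refl =
  trans (∈?-tab _ (c · M)) (trans (any-allVecs k _) (∃ᵇ-intro _ c (eqV-refl (c · M))))

∈span-elim : ∀ {k n} (M : Mat k n) {y : F2 n} → y ∈? span M ≡ true → Σ (F2 k) λ c → c · M ≡ y
∈span-elim {k} M {y} y∈ with ∃ᵇ-elim _ (trans (sym (trans (∈?-tab _ y) (any-allVecs k _))) y∈)
... | c , cM≟y = c , eqV-sound cM≟y

∈image-intro : ∀ {n} (A : SqMat n) (S : Sub n) (x : F2 n) → x ∈? S ≡ true → (x · A) ∈? image A S ≡ true
∈image-intro {n} A S x x∈S = trans (∈?-tab _ (x · A))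
  (trans (any-allVecs n _) (∃ᵇ-intro _ x (trans (cong (_∧ eqV (x · A) (x · A)) x∈S) (eqV-refl (x · A)))))

subspace-zero : ∀ {n k} {S : Sub n} → IsSubspaceDim k S → zeroV ∈? S ≡ true
subspace-zero (M , _ , refl) = ∈span-intro M zeroV (·-zeroˡ M)

subspace-⊕ : ∀ {n k} {S : Sub n} → IsSubspaceDim k S →
             ∀ {x y} → x ∈? S ≡ true → y ∈? S ≡ true → (x ⊕ y) ∈? S ≡ true
subspace-⊕ (M , _ , refl) {x} {y} x∈ y∈ with ∈span-elim M {x} x∈ | ∈span-elim M {y} y∈
... | c , refl | c′ , refl = ∈span-intro M (c ⊕ c′) (·-distrib-⊕ c c′ M)

-- A vector of the span has exactly one coordinate vector, so summing over the span
-- amounts to summing over all coordinate vectors.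
count-subspace : ∀ {n k} {S : Sub n} → IsSubspaceDim k S → count n (_∈? S) ≡ 2 ^ k
count-subspace {n} {k} (M , independent , refl) = begin
  count n (_∈? span M)
    ≡⟨ ∑-cong {n} (λ y → cong 𝟙 (trans (∈?-tab _ y) (any-allVecs k _))) ⟩
  ∑ n (λ y → 𝟙 (∃ᵇ k (λ c → eqV (c · M) y)))
    ≡⟨ ∑-cong {n} (λ y → 𝟙-∃ᵇ _ (λ c c′ e e′ →
         injective (trans (eqV-sound {x = c · M} e) (sym (eqV-sound {x = c′ · M} e′))))) ⟩
  ∑ n (λ y → count k (λ c → eqV (c · M) y))
    ≡⟨ ∑-comm n k _ ⟩
  ∑ k (λ c → count n (λ y → eqV (c · M) y))
    ≡⟨ ∑-cong (λ c → trans (count-cong (λ y → eqV-sym (c · M) y)) (count-singleton (c · M))) ⟩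
  ∑ k (λ _ → 1)
    ≡⟨ ∑-one k ⟩
  2 ^ k
    ∎
  where
  open ≡-Reasoning
  injective : ∀ {c c′} → c · M ≡ c′ · M → c ≡ c′
  injective {c} {c′} e = ⊕≡zero⇒≡ (independent (c ⊕ c′)
    (trans (·-distrib-⊕ c c′ M) (trans (cong (_⊕ (c′ · M)) e) (⊕-self _))))
  eqV-sym : ∀ {m} (x y : F2 m) → eqV x y ≡ eqV y x
  eqV-sym [] [] = refl
  eqV-sym (a ∷ x) (b ∷ y) = cong₂ (λ s t → not s ∧ t) (Boolₚ.xor-comm a b) (eqV-sym x y)

count-translate : ∀ {n} (p : F2 n → Bool) (t : F2 n) → count n (λ z → p (z ⊕ t)) ≡ count n p
count-translate p t = ∑-reindex (_⊕ t) (_⊕ t) (λ z → ⊕-cancelʳ z t) (λ z → ⊕-cancelʳ z t) (λ z → 𝟙 (p z))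

nonzero : ∀ {n} → F2 n → Bool
nonzero z = not (eqV z zeroV)

nonzero⇒≢ : ∀ {n} (x : F2 n) → nonzero x ≡ true → x ≢ zeroV
nonzero⇒≢ x nz refl with trans (sym nz) (cong not (eqV-refl x))
... | ()

∉⟨_⟩ : ∀ {n} → F2 n → F2 n → Bool
∉⟨ w ⟩ z = nonzero z ∧ not (eqV z w)

three≤count : ∀ {n} (p : F2 n → Bool) {a b c} → p a ≡ true → p b ≡ true → p c ≡ true →
              a ≢ b → a ≢ c → b ≢ c → 3 ≤ count n p
three≤count {n} p {a} {b} {c} pa pb pc a≢b a≢c b≢c = begin
  3
    ≡⟨ cong₂ (λ x y → x + (y + 1)) (count-singleton a) (count-singleton b) ⟨
  count n (_≡ᵥ a) + (count n (_≡ᵥ b) + 1)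
    ≡⟨ cong (λ x → count n (_≡ᵥ a) + (count n (_≡ᵥ b) + x)) (count-singleton c) ⟨
  count n (_≡ᵥ a) + (count n (_≡ᵥ b) + count n (_≡ᵥ c))
    ≡⟨ cong (count n (_≡ᵥ a) +_) (count-∨ (_≡ᵥ b) (_≡ᵥ c) (apart b≢c)) ⟨
  count n (_≡ᵥ a) + count n (λ z → z ≡ᵥ b ∨ z ≡ᵥ c)
    ≡⟨ count-∨ (_≡ᵥ a) (λ z → z ≡ᵥ b ∨ z ≡ᵥ c) a#bc ⟨
  count n (λ z → z ≡ᵥ a ∨ (z ≡ᵥ b ∨ z ≡ᵥ c))
    ≤⟨ count-mono ⊆p ⟩
  count n p
    ∎
  where
  open ≤-Reasoning
  _≡ᵥ_ : F2 n → F2 n → Bool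
  z ≡ᵥ x = eqV z x
  apart : ∀ {x y} → x ≢ y → ∀ z → z ≡ᵥ x ≡ true → z ≡ᵥ y ≡ true → ⊥
  apart x≢y z z≡x z≡y = x≢y (trans (sym (eqV-sound {x = z} z≡x)) (eqV-sound {x = z} z≡y))
  a#bc : ∀ z → z ≡ᵥ a ≡ true → (z ≡ᵥ b ∨ z ≡ᵥ c) ≡ true → ⊥
  a#bc z z≡a z≡b∨c with z ≡ᵥ b in z≡b
  ... | true = apart a≢b z z≡a z≡b
  ... | false = apart a≢c z z≡a z≡b∨c
  ⊆p : ∀ z → (z ≡ᵥ a ∨ (z ≡ᵥ b ∨ z ≡ᵥ c)) ≡ true → p z ≡ true
  ⊆p z z∈ with z ≡ᵥ a in z≡a | z ≡ᵥ b in z≡b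
  ... | true | _ = subst (λ t → p t ≡ true) (sym (eqV-sound z≡a)) pa
  ... | false | true = subst (λ t → p t ≡ true) (sym (eqV-sound z≡b)) pb
  ... | false | false = subst (λ t → p t ≡ true) (sym (eqV-sound z∈)) pc

count-remove-⟨⟩ : ∀ {n} (p : F2 n → Bool) (w : F2 n) → p zeroV ≡ true → p w ≡ true → w ≢ zeroV →
                  count n p ≡ count n (λ z → p z ∧ ∉⟨ w ⟩ z) + 2
count-remove-⟨⟩ {n} p w p0 pw w≢0 = begin
  count n p
    ≡⟨ count-remove p zeroV p0 ⟩
  count n p≠0 + 1
    ≡⟨ cong (_+ 1) (count-remove p≠0 w p≠0-w) ⟩
  count n (λ z → p≠0 z ∧ not (eqV z w)) + 1 + 1
    ≡⟨ +-assoc _ 1 1 ⟩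
  count n (λ z → p≠0 z ∧ not (eqV z w)) + 2
    ≡⟨ cong (_+ 2) (count-cong (λ z → Boolₚ.∧-assoc (p z) _ _)) ⟩
  count n (λ z → p z ∧ ∉⟨ w ⟩ z) + 2
    ∎
  where
  open ≡-Reasoning
  p≠0 : F2 n → Bool
  p≠0 z = p z ∧ nonzero z
  p≠0-w : p≠0 w ≡ true
  p≠0-w = trans (cong (λ b → p w ∧ not b) (eqV-≢ w≢0)) (trans (Boolₚ.∧-identityʳ _) pw)

pair : ∀ {n} → F2 n → F2 n → Mat 2 n
pair a b = a ∷ b ∷ []

IndependentPair : ∀ {n} → F2 n → F2 n → Set
IndependentPair a b = (a ≢ zeroV) × (b ≢ zeroV) × (a ≢ b)

independentPair? : ∀ {n} (a b : F2 n) → Dec (IndependentPair a b)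
independentPair? a b = ¬? (a ≟ᵥ zeroV) ×-dec ¬? (b ≟ᵥ zeroV) ×-dec ¬? (a ≟ᵥ b)

∉⟨⟩⇒independentPair : ∀ {n} {w z : F2 n} → w ≢ zeroV → ∉⟨ w ⟩ z ≡ true → IndependentPair w z
∉⟨⟩⇒independentPair {n} {w} {z} w≢0 z∉ = w≢0 , z≢0 , w≢z
  where
  z≢0 : z ≢ zeroV
  z≢0 refl with trans (sym z∉) (cong (λ b → not b ∧ not (eqV zeroV w)) (eqV-refl (zeroV {n})))
  ... | ()
  w≢z : w ≢ z
  w≢z refl with trans (sym z∉) (trans (cong (λ b → not (eqV w zeroV) ∧ not b) (eqV-refl w)) (Boolₚ.∧-zeroʳ _))
  ... | ()

pair-independent : ∀ {n} {a b : F2 n} → IndependentPair a b → Independent (pair a b)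
pair-independent _ (false ∷ false ∷ []) _ = refl
pair-independent (a≢0 , _ , _) (true ∷ false ∷ []) a⊕0≡0 = ⊥-elim (a≢0 (trans (sym (⊕-identityʳ _)) a⊕0≡0))
pair-independent (_ , b≢0 , _) (false ∷ true ∷ []) b⊕0≡0 = ⊥-elim (b≢0 (trans (sym (⊕-identityʳ _)) b⊕0≡0))
pair-independent {b = b} (_ , _ , a≢b) (true ∷ true ∷ []) e =
  ⊥-elim (a≢b (⊕≡zero⇒≡ (trans (cong (_ ⊕_) (sym (⊕-identityʳ b))) e)))

span-pair-elim : ∀ {n} {a b z : F2 n} (P : F2 n → Set) → P zeroV → P a → P b → P (a ⊕ b) →
                 z ∈? span (pair a b) ≡ true → P z
span-pair-elim {a = a} {b} {z} P P0 Pa Pb Pab z∈ with ∈span-elim (pair a b) {z} z∈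
... | false ∷ false ∷ [] , refl = P0
... | true ∷ false ∷ [] , refl = subst P (sym (⊕-identityʳ a)) Pa
... | false ∷ true ∷ [] , refl = subst P (sym (⊕-identityʳ b)) Pb
... | true ∷ true ∷ [] , refl = subst P (cong (a ⊕_) (sym (⊕-identityʳ b))) Pab

∈span-pairˡ : ∀ {n} (a b : F2 n) → a ∈? span (pair a b) ≡ true
∈span-pairˡ a b = ∈span-intro (pair a b) (true ∷ false ∷ []) (⊕-identityʳ a)

∈span-pairʳ : ∀ {n} (a b : F2 n) → b ∈? span (pair a b) ≡ true
∈span-pairʳ a b = ∈span-intro (pair a b) (false ∷ true ∷ []) (⊕-identityʳ b)

span-pair-⊆ : ∀ {n k} {S : Sub n} → IsSubspaceDim k S → ∀ {a b} → a ∈? S ≡ true → b ∈? S ≡ true →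
              span (pair a b) ⊆ S
span-pair-⊆ {S = S} sub {a} {b} a∈ b∈ z =
  span-pair-elim {a = a} {b} {z} (λ t → t ∈? S ≡ true) (subspace-zero sub) a∈ b∈ (subspace-⊕ sub {a} {b} a∈ b∈)

-- The cosets T, T ⊕ a and T ⊕ b would be pairwise disjoint, giving 4 + 4 + 4 points in a space of 8.
no-three-cosets : ∀ {n} {T S : Sub n} → IsSubspaceDim 2 T → IsSubspaceDim 3 S → T ⊆ S →
                  ∀ {a b} → a ∈? S ≡ true → b ∈? S ≡ true →
                  ¬ (a ∈? T ≡ true) → ¬ (b ∈? T ≡ true) → ¬ ((a ⊕ b) ∈? T ≡ true) → ⊥
no-three-cosets {n} {T} {S} T-sub S-sub T⊆S {a} {b} a∈S b∈S a∉T b∉T a⊕b∉T = <⇒≱ 8<12 12≤8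
  where
  8<12 : 8 < 12
  8<12 = s≤s (s≤s (s≤s (s≤s (s≤s (s≤s (s≤s (s≤s (s≤s z≤n))))))))

  _∈T : F2 n → Bool
  z ∈T = z ∈? T

  difference : ∀ z c d → (z ⊕ c) ∈T ≡ true → (z ⊕ d) ∈T ≡ true → (c ⊕ d) ∈T ≡ true
  difference z c d zc∈ zd∈ = subst (λ t → t ∈T ≡ true) cancel (subspace-⊕ T-sub {z ⊕ c} {z ⊕ d} zc∈ zd∈)
    where
    cancel : (z ⊕ c) ⊕ (z ⊕ d) ≡ c ⊕ d
    cancel = trans (⊕-interchange z c z d) (trans (cong (_⊕ (c ⊕ d)) (⊕-self z)) (⊕-identityˡ (c ⊕ d)))

  coset⊆S : ∀ {c} → c ∈? S ≡ true → ∀ z → (z ⊕ c) ∈T ≡ true → z ∈? S ≡ true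
  coset⊆S {c} c∈S z zc∈ =
    subst (λ t → t ∈? S ≡ true) (⊕-cancelʳ z c) (subspace-⊕ S-sub {z ⊕ c} {c} (T⊆S (z ⊕ c) zc∈) c∈S)

  in-coset : F2 n → F2 n → Bool
  in-coset c z = (z ⊕ c) ∈T

  T#a : ∀ z → z ∈T ≡ true → in-coset a z ≡ true → ⊥
  T#a z z∈ za∈ = a∉T (subst (λ t → t ∈T ≡ true) (⊕-cancelˡ z a) (subspace-⊕ T-sub {z} {z ⊕ a} z∈ za∈))

  T#b : ∀ z → z ∈T ≡ true → in-coset b z ≡ true → ⊥
  T#b z z∈ zb∈ = b∉T (subst (λ t → t ∈T ≡ true) (⊕-cancelˡ z b) (subspace-⊕ T-sub {z} {z ⊕ b} z∈ zb∈))

  a#b : ∀ z → in-coset a z ≡ true → in-coset b z ≡ true → ⊥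
  a#b z za∈ zb∈ = a⊕b∉T (difference z a b za∈ zb∈)

  T∪a#b : ∀ z → (z ∈T ∨ in-coset a z) ≡ true → in-coset b z ≡ true → ⊥
  T∪a#b z z∈ zb∈ with z ∈T in e
  ... | true = T#b z e zb∈
  ... | false = a#b z z∈ zb∈

  in-union⇒∈S : ∀ z → ((z ∈T ∨ in-coset a z) ∨ in-coset b z) ≡ true → z ∈? S ≡ true
  in-union⇒∈S z z∈ with z ∈T in e | in-coset a z in ea
  ... | true | _ = T⊆S z e
  ... | false | true = coset⊆S a∈S z ea
  ... | false | false = coset⊆S b∈S z z∈

  12≤8 : 12 ≤ 8
  12≤8 = begin
    12
      ≡⟨ cong₂ (λ x y → x + y + y) (count-subspace T-sub) (count-subspace T-sub) ⟨
    count n _∈T + count n _∈T + count n _∈T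
      ≡⟨ cong₂ (λ x y → count n _∈T + x + y) (count-translate _∈T a) (count-translate _∈T b) ⟨
    count n _∈T + count n (in-coset a) + count n (in-coset b)
      ≡⟨ cong (_+ count n (in-coset b)) (count-∨ _∈T (in-coset a) T#a) ⟨
    count n (λ z → z ∈T ∨ in-coset a z) + count n (in-coset b)
      ≡⟨ count-∨ (λ z → z ∈T ∨ in-coset a z) (in-coset b) T∪a#b ⟨
    count n (λ z → (z ∈T ∨ in-coset a z) ∨ in-coset b z)
      ≤⟨ count-mono in-union⇒∈S ⟩
    count n (_∈? S)
      ≡⟨ count-subspace S-sub ⟩
    8
      ∎
    where open ≤-Reasoning

-- Steiner systems of planes

module STS {v : ℕ} (D : Sub v → Bool) (sts : IsSTS2 v D) where

  block-subspace : ∀ {B} → D B ≡ true → IsSubspaceDim 3 B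
  block-subspace {B} = proj₁ sts B

  -- Junk value: the empty set when a and b do not span a plane.
  block : F2 v → F2 v → Sub v
  block a b with independentPair? a b
  ... | yes ab = proj₁ (proj₂ sts (span (pair a b)) (pair a b , pair-independent ab , refl))
  ... | no _ = tab (λ _ → false)

  private
    block-spec : ∀ {a b} → IndependentPair a b →
                 (D (block a b) ≡ true) × (span (pair a b) ⊆ block a b) ×
                 (∀ B → D B ≡ true → span (pair a b) ⊆ B → B ≡ block a b)
    block-spec {a} {b} ab with independentPair? a b
    ... | yes ab′ = proj₂ (proj₂ sts (span (pair a b)) (pair a b , pair-independent ab′ , refl))
    ... | no ¬ab = ⊥-elim (¬ab ab)

  block∈D : ∀ {a b} → IndependentPair a b → D (block a b) ≡ true
  block∈D ab = proj₁ (block-spec ab)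

  ∈blockˡ : ∀ {a b} → IndependentPair a b → a ∈? block a b ≡ true
  ∈blockˡ {a} {b} ab = proj₁ (proj₂ (block-spec ab)) a (∈span-pairˡ a b)

  ∈blockʳ : ∀ {a b} → IndependentPair a b → b ∈? block a b ≡ true
  ∈blockʳ {a} {b} ab = proj₁ (proj₂ (block-spec ab)) b (∈span-pairʳ a b)

  block-unique : ∀ {a b B} → IndependentPair a b → D B ≡ true → a ∈? B ≡ true → b ∈? B ≡ true →
                 B ≡ block a b
  block-unique {a} {b} {B} ab B∈D a∈B b∈B =
    proj₂ (proj₂ (block-spec ab)) B B∈D (span-pair-⊆ (block-subspace B∈D) {a} {b} a∈B b∈B)

  count-block : ∀ {B} → D B ≡ true → count v (_∈? B) ≡ 8
  count-block B∈D = count-subspace (block-subspace B∈D)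

  count-block-∉⟨⟩ : ∀ {w y} → IndependentPair w y → count v (λ z → z ∈? block w y ∧ ∉⟨ w ⟩ z) ≡ 6
  count-block-∉⟨⟩ {w} {y} wy@(w≢0 , _) = +-cancelʳ-≡ 2 _ 6 (trans
    (sym (count-remove-⟨⟩ (_∈? block w y) w (subspace-zero (block-subspace (block∈D wy)))
                          (∈blockˡ wy) w≢0))
    (count-block (block∈D wy)))

  -- The blocks through a nonzero w partition the points outside {0, w} into classes of six.
  sts-order : ∀ (w : F2 v) → w ≢ zeroV → 6 ∣ 2 ^ v ∸ 2
  sts-order w w≢0 =
    subst (6 ∣_) outside≡ (count-classes 6 (∉⟨ w ⟩) (λ y z → z ∈? block w y) size euclid)
    where
    independent : ∀ y → ∉⟨ w ⟩ y ≡ true → IndependentPair w y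
    independent y = ∉⟨⟩⇒independentPair {w = w} {y} w≢0

    same-block : ∀ y z → ∉⟨ w ⟩ y ≡ true → ∉⟨ w ⟩ z ≡ true → z ∈? block w y ≡ true → block w y ≡ block w z
    same-block y z y∉ z∉ z∈ =
      block-unique (independent z z∉) (block∈D (independent y y∉)) (∈blockˡ (independent y y∉)) z∈

    size : ∀ y → ∉⟨ w ⟩ y ≡ true → count v (λ z → ∉⟨ w ⟩ z ∧ (z ∈? block w y)) ≡ 6
    size y y∉ = trans (count-cong (λ z → Boolₚ.∧-comm (∉⟨ w ⟩ z) _)) (count-block-∉⟨⟩ (independent y y∉))

    euclid : ∀ y z u → ∉⟨ w ⟩ y ≡ true → ∉⟨ w ⟩ z ≡ true → ∉⟨ w ⟩ u ≡ true →
             u ∈? block w y ≡ true → u ∈? block w z ≡ true → z ∈? block w y ≡ true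
    euclid y z u y∉ z∉ u∉ u∈y u∈z =
      subst (λ B → z ∈? B ≡ true) (trans (same-block z u z∉ u∉ u∈z) (sym (same-block y u y∉ u∉ u∈y)))
            (∈blockʳ (independent z z∉))

    outside≡ : count v (∉⟨ w ⟩) ≡ 2 ^ v ∸ 2
    outside≡ = sym (trans
      (cong (_∸ 2) (trans (sym (∑-one v)) (count-remove-⟨⟩ (λ _ → true) w refl refl w≢0)))
      (m+n∸n≡m _ 2))

-- Automorphisms of order three

Fixes : ∀ {n} → SqMat n → F2 n → Bool
Fixes M x = eqV (x · M) x

InKerΦ₃ : ∀ {n} → SqMat n → F2 n → Bool
InKerΦ₃ M x = eqV ((x · M) · M) (x ⊕ (x · M))

module Automorphism {v : ℕ} (D : Sub v → Bool) (sts : IsSTS2 v D) (A : SqMat v)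
                    (A³≡Id : A ⊗ (A ⊗ A) ≡ Id) (D-invariant : ∀ B → D (image A B) ≡ D B) where

  open STS D sts

  α : F2 v → F2 v
  α x = x · A

  α³ : ∀ x → α (α (α x)) ≡ x
  α³ x = begin
    α (α (α x))       ≡⟨ ·-⊗ (x · A) A A ⟨
    α x · (A ⊗ A)     ≡⟨ ·-⊗ x A (A ⊗ A) ⟨
    x · (A ⊗ (A ⊗ A)) ≡⟨ cong (x ·_) A³≡Id ⟩
    x · Id            ≡⟨ ·-Id x ⟩
    x                 ∎
    where open ≡-Reasoning

  α-injective : ∀ {x y} → α x ≡ α y → x ≡ y
  α-injective {x} {y} αx≡αy = trans (sym (α³ x)) (trans (cong (λ t → α (α t)) αx≡αy) (α³ y))

  α-⊕ : ∀ x y → α (x ⊕ y) ≡ α x ⊕ α y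
  α-⊕ x y = ·-distrib-⊕ x y A

  α-zero : α zeroV ≡ zeroV
  α-zero = ·-zeroˡ A

  α-≢ : ∀ {x y} → x ≢ y → α x ≢ α y
  α-≢ x≢y αx≡αy = x≢y (α-injective αx≡αy)

  α-≢zero : ∀ {x} → x ≢ zeroV → α x ≢ zeroV
  α-≢zero x≢0 αx≡0 = x≢0 (α-injective (trans αx≡0 (sym α-zero)))

  α-independentPair : ∀ {a b} → IndependentPair a b → IndependentPair (α a) (α b)
  α-independentPair (a≢0 , b≢0 , a≢b) = α-≢zero a≢0 , α-≢zero b≢0 , α-≢ a≢b

  image-block : ∀ {a b} → IndependentPair a b → image A (block a b) ≡ block (α a) (α b)
  image-block {a} {b} ab = block-unique (α-independentPair ab) (trans (D-invariant _) (block∈D ab))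
    (∈image-intro A _ a (∈blockˡ ab)) (∈image-intro A _ b (∈blockʳ ab))

  α-∈block : ∀ {a b} z → IndependentPair a b → z ∈? block a b ≡ true → α z ∈? block (α a) (α b) ≡ true
  α-∈block z ab z∈ = subst (λ B → α z ∈? B ≡ true) (image-block ab) (∈image-intro A _ z z∈)

  Moved : F2 v → Bool
  Moved x = not (Fixes A x)

  moved⇒≢ : ∀ {x} → Moved x ≡ true → α x ≢ x
  moved⇒≢ {x} moved αx≡x with trans (sym moved) (cong not (eqV-complete αx≡x))
  ... | ()

  ≢⇒moved : ∀ {x} → α x ≢ x → Moved x ≡ true
  ≢⇒moved αx≢x = cong not (eqV-≢ αx≢x)

  unmoved⇒≡ : ∀ {x} → Moved x ≡ false → α x ≡ x
  unmoved⇒≡ {x} unmoved = eqV-sound {x = α x} (Boolₚ.not-injective unmoved)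

  α-moved : ∀ {x} → α x ≢ x → α (α x) ≢ α x
  α-moved αx≢x = α-≢ αx≢x

  -- (y ⊕ αy) being fixed would force α² y = y, hence y = α³ y = α y.
  ⊕α-moved : ∀ {y} → α y ≢ y → α (y ⊕ α y) ≢ y ⊕ α y
  ⊕α-moved {y} αy≢y fixed = αy≢y (trans (sym (cong α α²y≡y)) (α³ y))
    where
    α²y≡y : α (α y) ≡ y
    α²y≡y = begin
      α (α y)                   ≡⟨ ⊕-cancelˡ (α y) (α (α y)) ⟨
      α y ⊕ (α y ⊕ α (α y))     ≡⟨ cong (α y ⊕_) (trans (sym (α-⊕ y (α y))) fixed) ⟩
      α y ⊕ (y ⊕ α y)           ≡⟨ cong (α y ⊕_) (⊕-comm y (α y)) ⟩
      α y ⊕ (α y ⊕ y)           ≡⟨ ⊕-cancelˡ (α y) y ⟩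
      y                         ∎
      where open ≡-Reasoning

  α^ : ℕ → F2 v → F2 v
  α^ zero x = x
  α^ (suc i) x = α (α^ i x)

  α^-+ : ∀ i j x → α^ (i + j) x ≡ α^ i (α^ j x)
  α^-+ zero j x = refl
  α^-+ (suc i) j x = cong α (α^-+ i j x)

  α^-*3 : ∀ j x → α^ (j * 3) x ≡ x
  α^-*3 zero x = refl
  α^-*3 (suc j) x = trans (α³ (α^ (j * 3) x)) (α^-*3 j x)

  α^-%3 : ∀ i x → α^ i x ≡ α^ (i % 3) x
  α^-%3 i x = begin
    α^ i x                              ≡⟨ cong (λ k → α^ k x) (m≡m%n+[m/n]*n i 3) ⟩
    α^ (i % 3 + (i / 3) * 3) x          ≡⟨ α^-+ (i % 3) ((i / 3) * 3) x ⟩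
    α^ (i % 3) (α^ ((i / 3) * 3) x)     ≡⟨ cong (α^ (i % 3)) (α^-*3 (i / 3) x) ⟩
    α^ (i % 3) x                        ∎
    where open ≡-Reasoning

  α^-moved : ∀ i {x} → α x ≢ x → α (α^ i x) ≢ α^ i x
  α^-moved zero αx≢x = αx≢x
  α^-moved (suc i) αx≢x = α-moved (α^-moved i αx≢x)

  module Through (w : F2 v) (w≢0 : w ≢ zeroV) (αw≡w : α w ≡ w) where

    moved-independent : ∀ {y} → α y ≢ y → IndependentPair w y
    moved-independent {y} αy≢y =
      w≢0 , (λ y≡0 → αy≢y (trans (cong α y≡0) (trans α-zero (sym y≡0))))
          , (λ w≡y → αy≢y (trans (cong α (sym w≡y)) (trans αw≡w w≡y)))

    -- A second nonzero fixed point w′ would make the block the α-invariant block through w and w′,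
    -- containing the fixed plane ⟨w, w′⟩ and both y and α y outside it.
    block-∩-fixed : ∀ {y w′} → α y ≢ y → w′ ∈? block w y ≡ true → α w′ ≡ w′ → (w′ ≡ zeroV) ⊎ (w′ ≡ w)
    block-∩-fixed {y} {w′} αy≢y w′∈ αw′≡w′ with w′ ≟ᵥ zeroV | w′ ≟ᵥ w
    ... | yes w′≡0 | _ = inj₁ w′≡0
    ... | no _ | yes w′≡w = inj₂ w′≡w
    ... | no w′≢0 | no w′≢w = ⊥-elim $ no-three-cosets T-sub (block-subspace (block∈D wy)) T⊆B
                                {y} {α y} (∈blockʳ wy) (invariant y (∈blockʳ wy))
                                (λ y∈T → αy≢y (T-fixed y y∈T))
                                (λ αy∈T → α-moved αy≢y (T-fixed (α y) αy∈T))
                                (λ y⊕αy∈T → ⊕α-moved αy≢y (T-fixed (y ⊕ α y) y⊕αy∈T))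
      where
      wy = moved-independent αy≢y

      ww′ : IndependentPair w w′
      ww′ = w≢0 , w′≢0 , (λ w≡w′ → w′≢w (sym w≡w′))

      B≡ : block w y ≡ block w w′
      B≡ = block-unique ww′ (block∈D wy) (∈blockˡ wy) w′∈

      invariant : ∀ x → x ∈? block w y ≡ true → α x ∈? block w y ≡ true
      invariant x x∈ = subst (λ S → α x ∈? S ≡ true) (trans (cong₂ block αw≡w αw′≡w′) (sym B≡))
                               (α-∈block x ww′ (subst (λ S → x ∈? S ≡ true) B≡ x∈))

      T-sub : IsSubspaceDim 2 (span (pair w w′))
      T-sub = pair w w′ , pair-independent ww′ , refl

      T⊆B : span (pair w w′) ⊆ block w y
      T⊆B = span-pair-⊆ (block-subspace (block∈D wy)) {w} {w′} (∈blockˡ wy) w′∈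

      T-fixed : ∀ z → z ∈? span (pair w w′) ≡ true → α z ≡ z
      T-fixed z = span-pair-elim {a = w} {w′} {z} (λ t → α t ≡ t) α-zero αw≡w αw′≡w′
                      (trans (α-⊕ w w′) (cong₂ _⊕_ αw≡w αw′≡w′))

    count-moved-in-block : ∀ {y} → α y ≢ y → count v (λ z → Moved z ∧ z ∈? block w y) ≡ 6
    count-moved-in-block {y} αy≢y =
      trans (count-cong moved⇔∉⟨w⟩) (count-block-∉⟨⟩ (moved-independent {y} αy≢y))
      where
      moved⇔∉⟨w⟩ : ∀ z → Moved z ∧ z ∈? block w y ≡ z ∈? block w y ∧ ∉⟨ w ⟩ z
      moved⇔∉⟨w⟩ z with z ∈? block w y in z∈ | Moved z in mz
      ... | false | _ = Boolₚ.∧-zeroʳ _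
      ... | true | true = sym (cong₂ (λ a b → not a ∧ not b) (eqV-≢ z≢0) (eqV-≢ z≢w))
        where
        z≢0 : z ≢ zeroV
        z≢0 refl = moved⇒≢ mz α-zero
        z≢w : z ≢ w
        z≢w refl = moved⇒≢ mz αw≡w
      ... | true | false with block-∩-fixed {y} {z} αy≢y z∈ (unmoved⇒≡ mz)
      ...   | inj₁ refl = cong (λ b → not b ∧ not (eqV zeroV w)) (sym (eqV-refl (zeroV {v})))
      ...   | inj₂ refl =
        sym (trans (cong (λ b → not (eqV w zeroV) ∧ not b) (eqV-refl w)) (Boolₚ.∧-zeroʳ _))

    same-block : ∀ y z → α y ≢ y → α z ≢ z → z ∈? block w y ≡ true → block w z ≡ block w y
    same-block y z αy≢y αz≢z z∈ =
      sym (block-unique (moved-independent αz≢z) (block∈D wy) (∈blockˡ wy) z∈)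
      where wy = moved-independent αy≢y

    α-block : ∀ {y} → α y ≢ y → image A (block w y) ≡ block w (α y)
    α-block αy≢y = trans (image-block (moved-independent αy≢y)) (cong (λ t → block t _) αw≡w)

    α^-block : ∀ i {y z} → α y ≢ y → α z ≢ z → block w y ≡ block w z →
               block w (α^ i y) ≡ block w (α^ i z)
    α^-block zero _ _ B≡ = B≡
    α^-block (suc i) {y} {z} αy≢y αz≢z B≡ = begin
      block w (α (α^ i y))        ≡⟨ α-block (α^-moved i αy≢y) ⟨
      image A (block w (α^ i y))  ≡⟨ cong (image A) (α^-block i αy≢y αz≢z B≡) ⟩
      image A (block w (α^ i z))  ≡⟨ α-block (α^-moved i αz≢z) ⟩
      block w (α (α^ i z))        ∎
      where open ≡-Reasoning

    InOrbit : F2 v → F2 v → Bool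
    InOrbit y z = z ∈? block w y ∨ (z ∈? block w (α y) ∨ z ∈? block w (α (α y)))

    inOrbit⇒ : ∀ y z → α y ≢ y → α z ≢ z → InOrbit y z ≡ true → Σ ℕ λ i → block w z ≡ block w (α^ i y)
    inOrbit⇒ y z αy≢y αz≢z z∈ with z ∈? block w y in z∈₀ | z ∈? block w (α y) in z∈₁
    ... | true | _ = 0 , same-block y z αy≢y αz≢z z∈₀
    ... | false | true = 1 , same-block (α y) z (α-moved αy≢y) αz≢z z∈₁
    ... | false | false = 2 , same-block (α (α y)) z (α-moved (α-moved αy≢y)) αz≢z z∈

    ⇒inOrbit : ∀ i y z → α z ≢ z → block w z ≡ block w (α^ i y) → InOrbit y z ≡ true
    ⇒inOrbit i y z αz≢z B≡ with i % 3 | m%n<n i 3 | z∈block (trans B≡ (cong (block w) (α^-%3 i y)))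
      where
      z∈block : ∀ {B} → block w z ≡ B → z ∈? B ≡ true
      z∈block {B} B≡ = subst (λ t → z ∈? t ≡ true) B≡ (∈blockʳ (moved-independent αz≢z))
    ... | 0 | _ | z∈ = ∨-introˡ z∈
    ... | 1 | _ | z∈ = ∨-introʳ (z ∈? block w y) (∨-introˡ z∈)
    ... | 2 | _ | z∈ = ∨-introʳ (z ∈? block w y) (∨-introʳ (z ∈? block w (α y)) z∈)
    ... | suc (suc (suc _)) | s≤s (s≤s (s≤s ())) | _

    -- Without an α-invariant block through w, the blocks through w meeting the moved points fall
    -- into α-orbits of three distinct blocks, which pairwise share only 0 and w.
    no-invariant-block⇒18∣moved : (∀ y → α y ≢ y → α y ∈? block w y ≡ false) → 18 ∣ count v Moved
    no-invariant-block⇒18∣moved no-invariant =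
      count-classes 18 Moved InOrbit size euclid
      where
      block≢α-block : ∀ {y} → α y ≢ y → block w y ≢ block w (α y)
      block≢α-block {y} αy≢y B≡ with trans (sym (no-invariant y αy≢y))
        (subst (λ B → α y ∈? B ≡ true) (sym B≡) (∈blockʳ (moved-independent (α-moved αy≢y))))
      ... | ()

      meet : ∀ a b z → α a ≢ a → α b ≢ b → α z ≢ z → z ∈? block w a ≡ true → z ∈? block w b ≡ true →
             block w a ≡ block w b
      meet a b z αa≢a αb≢b αz≢z z∈a z∈b =
        trans (sym (same-block a z αa≢a αz≢z z∈a)) (same-block b z αb≢b αz≢z z∈b)

      size : ∀ y → Moved y ≡ true → count v (λ z → Moved z ∧ InOrbit y z) ≡ 18
      size y moved = begin
        count v (λ z → Moved z ∧ InOrbit y z)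
          ≡⟨ count-cong (λ z → trans (Boolₚ.∧-distribˡ-∨ (Moved z) _ _)
               (cong ((Moved z ∧ z ∈? block w y) ∨_) (Boolₚ.∧-distribˡ-∨ (Moved z) _ _))) ⟩
        count v (λ z → in₀ z ∨ (in₁ z ∨ in₂ z))
          ≡⟨ count-∨ in₀ (λ z → in₁ z ∨ in₂ z) disjoint₀ ⟩
        count v in₀ + count v (λ z → in₁ z ∨ in₂ z)
          ≡⟨ cong (count v in₀ +_) (count-∨ in₁ in₂ disjoint₁₂) ⟩
        count v in₀ + (count v in₁ + count v in₂)
          ≡⟨ cong₂ (λ a b → a + (b + count v in₂)) (count-moved-in-block αy≢y) (count-moved-in-block αy≢y₁) ⟩
        6 + (6 + count v in₂)
          ≡⟨ cong (λ c → 6 + (6 + c)) (count-moved-in-block αy≢y₂) ⟩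
        18
          ∎
        where
        open ≡-Reasoning
        αy≢y = moved⇒≢ moved
        αy≢y₁ = α-moved αy≢y
        αy≢y₂ = α-moved αy≢y₁

        in₀ in₁ in₂ : F2 v → Bool
        in₀ z = Moved z ∧ z ∈? block w y
        in₁ z = Moved z ∧ z ∈? block w (α y)
        in₂ z = Moved z ∧ z ∈? block w (α (α y))

        split : ∀ {a b} → Moved a ∧ b ≡ true → (α a ≢ a) × (b ≡ true)
        split {a} m∧b = moved⇒≢ (Boolₚ.∧-conicalˡ _ _ m∧b) , Boolₚ.∧-conicalʳ (Moved a) _ m∧b

        disjoint₁₂ : ∀ z → in₁ z ≡ true → in₂ z ≡ true → ⊥
        disjoint₁₂ z z₁ z₂ with split {z} z₁ | split {z} z₂
        ... | αz≢z , z∈₁ | _ , z∈₂ =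
          block≢α-block αy≢y₁ (meet (α y) (α (α y)) z αy≢y₁ αy≢y₂ αz≢z z∈₁ z∈₂)

        disjoint₀ : ∀ z → in₀ z ≡ true → (in₁ z ∨ in₂ z) ≡ true → ⊥
        disjoint₀ z z₀ z₁₂ with split {z} z₀ | in₁ z in e₁
        ... | αz≢z , z∈₀ | true =
          block≢α-block αy≢y (meet y (α y) z αy≢y αy≢y₁ αz≢z z∈₀ (proj₂ (split {z} e₁)))
        ... | αz≢z , z∈₀ | false =
          block≢α-block αy≢y₂ (trans
            (sym (meet y (α (α y)) z αy≢y αy≢y₂ αz≢z z∈₀ (proj₂ (split {z} z₁₂))))
            (cong (block w) (sym (α³ y))))

      euclid : ∀ y z u → Moved y ≡ true → Moved z ≡ true → Moved u ≡ true →
               InOrbit y u ≡ true → InOrbit z u ≡ true → InOrbit y z ≡ true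
      euclid y z u my mz mu u∈y u∈z with inOrbit⇒ y u αy≢y αu≢u u∈y | inOrbit⇒ z u αz≢z αu≢u u∈z
        where
        αy≢y = moved⇒≢ my
        αz≢z = moved⇒≢ mz
        αu≢u = moved⇒≢ mu
      ... | i , Bu≡Byi | j , Bu≡Bzj = ⇒inOrbit (j + j + i) y z (moved⇒≢ mz) (begin
        block w z                             ≡⟨ cong (block w) (α^-*3 j z) ⟨
        block w (α^ (j * 3) z)                ≡⟨ cong (λ k → block w (α^ k z)) (j+j+j≡j*3 j) ⟨
        block w (α^ (j + j + j) z)            ≡⟨ cong (block w) (α^-+ (j + j) j z) ⟩
        block w (α^ (j + j) (α^ j z))         ≡⟨ α^-block (j + j) (α^-moved j (moved⇒≢ mz)) (α^-moved i (moved⇒≢ my))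
                                                   (trans (sym Bu≡Bzj) Bu≡Byi) ⟩
        block w (α^ (j + j) (α^ i y))         ≡⟨ cong (block w) (α^-+ (j + j) i y) ⟨
        block w (α^ (j + j + i) y)            ∎)
        where
        open ≡-Reasoning
        j+j+j≡j*3 : ∀ j → j + j + j ≡ j * 3
        j+j+j≡j*3 = solve-∀

  InU : F2 v → Bool
  InU = InKerΦ₃ A

  InU-α : ∀ {x} → α (α x) ≡ x ⊕ α x → α (α (α x)) ≡ α x ⊕ α (α x)
  InU-α {x} e = trans (cong α e) (α-⊕ x (α x))

  InU-moved : ∀ {x} → x ≢ zeroV → α (α x) ≡ x ⊕ α x → α x ≢ x
  InU-moved {x} x≢0 e αx≡x = x≢0 (begin
    x               ≡⟨ trans (cong α αx≡x) αx≡x ⟨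
    α (α x)         ≡⟨ e ⟩
    x ⊕ α x         ≡⟨ cong (x ⊕_) αx≡x ⟩
    x ⊕ x           ≡⟨ ⊕-self x ⟩
    zeroV           ∎)
    where open ≡-Reasoning

  -- u = α y ⊕ α² y satisfies α² u = y ⊕ α y = u ⊕ α u.
  ⊕α-InU : ∀ y → α (α (α y ⊕ α (α y))) ≡ (α y ⊕ α (α y)) ⊕ α (α y ⊕ α (α y))
  ⊕α-InU y = trans (cong α αu) (trans (α-⊕ (α (α y)) y) (trans (cong (_⊕ α y) (α³ y)) (sym u⊕αu)))
    where
    αu : α (α y ⊕ α (α y)) ≡ α (α y) ⊕ y
    αu = trans (α-⊕ (α y) (α (α y))) (cong (α (α y) ⊕_) (α³ y))
    u⊕αu : (α y ⊕ α (α y)) ⊕ α (α y ⊕ α (α y)) ≡ y ⊕ α y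
    u⊕αu = trans (cong ((α y ⊕ α (α y)) ⊕_) αu)
                 (trans (⊕-assoc (α y) (α (α y)) _)
                        (trans (cong (α y ⊕_) (⊕-cancelˡ (α (α y)) y)) (⊕-comm (α y) y)))

  NonzeroFixed NonzeroInU : F2 v → Bool
  NonzeroFixed x = Fixes A x ∧ nonzero x
  NonzeroInU x = InU x ∧ nonzero x

  nonzeroFixed⇒ : ∀ {w} → NonzeroFixed w ≡ true → (w ≢ zeroV) × (α w ≡ w)
  nonzeroFixed⇒ {w} e = nonzero⇒≢ w (Boolₚ.∧-conicalʳ (Fixes A w) _ e) ,
                        eqV-sound {x = α w} (Boolₚ.∧-conicalˡ _ _ e)

  count-Moved+Fixes : count v Moved + count v (Fixes A) ≡ 2 ^ v
  count-Moved+Fixes =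
    trans (+-comm (count v Moved) _) (trans (sym (count-split (λ _ → true) (Fixes A))) (∑-one v))

  count-NonzeroFixed : count v NonzeroFixed + 1 ≡ count v (Fixes A)
  count-NonzeroFixed = sym (count-remove (Fixes A) zeroV (eqV-complete α-zero))

  count-NonzeroInU : count v NonzeroInU + 1 ≡ count v InU
  count-NonzeroInU = sym (count-remove InU zeroV (eqV-complete 0∈U))
    where
    0∈U : α (α zeroV) ≡ zeroV ⊕ α zeroV
    0∈U = trans (cong α α-zero) (trans α-zero (sym (trans (cong (zeroV ⊕_) α-zero) (⊕-self zeroV))))

  InvariantBlock : F2 v → F2 v → Bool
  InvariantBlock w y = Moved y ∧ α y ∈? block w y

  18∤moved⇒invariant-blocks : ¬ (18 ∣ count v Moved) →
                              ∀ w → w ≢ zeroV → α w ≡ w → Σ (F2 v) λ y → InvariantBlock w y ≡ true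
  18∤moved⇒invariant-blocks 18∤moved w w≢0 αw≡w with search v (InvariantBlock w)
  ... | inj₁ witness = witness
  ... | inj₂ none = ⊥-elim (18∤moved (Through.no-invariant-block⇒18∣moved w w≢0 αw≡w
        (λ y αy≢y → trans (sym (cong (_∧ (α y ∈? block w y)) (≢⇒moved αy≢y))) (none y))))

  -- Every invariant block through a nonzero fixed w holds the three nonzero points u, α u, α² u of U,
  -- and a nonzero point z of U lies in the invariant block of at most one w, namely the block
  -- through z and α z.
  invariant-blocks⇒3W≤U : (∀ w → w ≢ zeroV → α w ≡ w → Σ (F2 v) λ y → InvariantBlock w y ≡ true) →
                          3 * count v NonzeroFixed ≤ count v NonzeroInU
  invariant-blocks⇒3W≤U has-invariant = begin
    3 * count v NonzeroFixed                  ≡⟨ ∑-distribˡ-* v 3 (λ w → 𝟙 (NonzeroFixed w)) ⟨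
    ∑ v (λ w → 3 * 𝟙 (NonzeroFixed w))        ≤⟨ ∑-mono-≤ three-per-w ⟩
    ∑ v (λ w → count v (Q w))                 ≡⟨ ∑-comm v v (λ w z → 𝟙 (Q w z)) ⟩
    ∑ v (λ z → count v (λ w → Q w z))         ≤⟨ ∑-mono-≤ at-most-one-per-z ⟩
    count v NonzeroInU                        ∎
    where
    open ≤-Reasoning

    point : F2 v → F2 v
    point w with search v (InvariantBlock w)
    ... | inj₁ (y , _) = y
    ... | inj₂ _ = zeroV

    point-invariant : ∀ w → w ≢ zeroV → α w ≡ w → InvariantBlock w (point w) ≡ true
    point-invariant w w≢0 αw≡w with search v (InvariantBlock w)
    ... | inj₁ (_ , inv) = inv
    ... | inj₂ none with has-invariant w w≢0 αw≡w
    ...   | y , inv with trans (sym (none y)) inv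
    ...     | ()

    Q : F2 v → F2 v → Bool
    Q w z = NonzeroFixed w ∧ (NonzeroInU z ∧ z ∈? block w (point w))

    module _ (w : F2 v) (fixed : NonzeroFixed w ≡ true) where
      open Through w (proj₁ (nonzeroFixed⇒ fixed)) (proj₂ (nonzeroFixed⇒ fixed))
      y = point w
      inv = point-invariant w (proj₁ (nonzeroFixed⇒ fixed)) (proj₂ (nonzeroFixed⇒ fixed))
      αy≢y = moved⇒≢ (Boolₚ.∧-conicalˡ _ _ inv)
      wy = moved-independent αy≢y

      invariant : ∀ x → x ∈? block w y ≡ true → α x ∈? block w y ≡ true
      invariant x x∈ = subst (λ B → α x ∈? B ≡ true)
        (trans (α-block αy≢y) (same-block y (α y) αy≢y (α-moved αy≢y) (Boolₚ.∧-conicalʳ (Moved y) _ inv)))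
        (∈image-intro A _ x x∈)

      u : F2 v
      u = α y ⊕ α (α y)

      u≢0 : u ≢ zeroV
      u≢0 u≡0 = α-moved αy≢y (sym (⊕≡zero⇒≡ u≡0))

      u∈ : u ∈? block w y ≡ true
      u∈ = subspace-⊕ (block-subspace (block∈D wy)) {α y} {α (α y)}
             (invariant y (∈blockʳ wy)) (invariant (α y) (invariant y (∈blockʳ wy)))

      nonzeroInU : ∀ {x} → x ≢ zeroV → α (α x) ≡ x ⊕ α x → NonzeroInU x ≡ true
      nonzeroInU x≢0 e = cong₂ _∧_ (eqV-complete e) (cong not (eqV-≢ x≢0))

      three-in-block : 3 ≤ count v (Q w)
      three-in-block =
        subst (3 ≤_) (count-cong (λ z → sym (cong (λ b → b ∧ (NonzeroInU z ∧ z ∈? block w y)) fixed))) $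
        three≤count (λ z → NonzeroInU z ∧ z ∈? block w y) {u} {α u} {α (α u)}
          (cong₂ _∧_ (nonzeroInU u≢0 (⊕α-InU y)) u∈)
          (cong₂ _∧_ (nonzeroInU (α-≢zero u≢0) (InU-α (⊕α-InU y))) (invariant u u∈))
          (cong₂ _∧_ (nonzeroInU (α-≢zero (α-≢zero u≢0)) (InU-α (InU-α (⊕α-InU y))))
                     (invariant (α u) (invariant u u∈)))
          (λ e → αu≢u (sym e)) (λ e → αu≢u (trans (cong α e) (α³ u))) (λ e → αu≢u (sym (α-injective e)))
        where
        αu≢u = InU-moved u≢0 (⊕α-InU y)

      block≡ : ∀ z → NonzeroInU z ≡ true → z ∈? block w y ≡ true → block w y ≡ block z (α z)
      block≡ z nz z∈ = block-unique (z≢0 , α-≢zero z≢0 , λ e → αz≢z (sym e)) (block∈D wy) z∈ (invariant z z∈)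
        where
        z≢0 = nonzero⇒≢ z (Boolₚ.∧-conicalʳ (InU z) _ nz)
        αz≢z = InU-moved z≢0 (eqV-sound {x = α (α z)} (Boolₚ.∧-conicalˡ _ _ nz))

      fixed-in-block : ∀ {b} → NonzeroFixed b ≡ true → b ∈? block w y ≡ true → b ≡ w
      fixed-in-block {b} fixedᵇ b∈ with block-∩-fixed {y} {b} αy≢y b∈ (proj₂ (nonzeroFixed⇒ fixedᵇ))
      ... | inj₁ b≡0 = ⊥-elim (proj₁ (nonzeroFixed⇒ fixedᵇ) b≡0)
      ... | inj₂ b≡w = b≡w

    three-per-w : ∀ w → 3 * 𝟙 (NonzeroFixed w) ≤ count v (Q w)
    three-per-w w = by-cases (NonzeroFixed w) refl
      where
      by-cases : ∀ b → NonzeroFixed w ≡ b → 3 * 𝟙 b ≤ count v (Q w)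
      by-cases false _ = z≤n
      by-cases true fixed = three-in-block w fixed

    at-most-one-per-z : ∀ z → count v (λ w → Q w z) ≤ 𝟙 (NonzeroInU z)
    at-most-one-per-z z = by-cases (NonzeroInU z) refl
      where
      by-cases : ∀ b → NonzeroInU z ≡ b → count v (λ w → Q w z) ≤ 𝟙 b
      by-cases false nz = ≤-reflexive (count-none (λ w →
        trans (cong (λ c → NonzeroFixed w ∧ (c ∧ z ∈? block w (point w))) nz) (Boolₚ.∧-zeroʳ (NonzeroFixed w))))
      by-cases true nz = count-≤1 (λ w → Q w z) unique
        where
        unique : ∀ a b → Q a z ≡ true → Q b z ≡ true → a ≡ b
        unique a b Qa Qb = sym (fixed-in-block a fixedᵃ fixedᵇ
          (subst (λ B → b ∈? B ≡ true) (trans (block≡ b fixedᵇ z nz z∈ᵇ) (sym (block≡ a fixedᵃ z nz z∈ᵃ)))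
                 (∈blockˡ (wy b fixedᵇ))))
          where
          fixedᵃ = Boolₚ.∧-conicalˡ _ _ Qa
          fixedᵇ = Boolₚ.∧-conicalˡ _ _ Qb
          z∈ᵃ = Boolₚ.∧-conicalʳ (NonzeroInU z) _ (Boolₚ.∧-conicalʳ (NonzeroFixed a) _ Qa)
          z∈ᵇ = Boolₚ.∧-conicalʳ (NonzeroInU z) _ (Boolₚ.∧-conicalʳ (NonzeroFixed b) _ Qb)

-- Conjugation and the normal forms A_{v,f}

eqV-injective : ∀ {n} (φ : F2 n → F2 n) → (∀ {x y} → φ x ≡ φ y → x ≡ y) → ∀ x y → eqV (φ x) (φ y) ≡ eqV x y
eqV-injective φ φ-injective x y with eqV x y in e
... | true = eqV-complete (cong φ (eqV-sound {x = x} e))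
... | false = eqV-≢ (λ φx≡φy → x≢y (φ-injective φx≡φy))
  where
  x≢y : x ≢ y
  x≢y x≡y with trans (sym e) (eqV-complete x≡y)
  ... | ()

-- x ↦ x P maps the fixed points and the kernel of M² + M + 1 of A onto those of T.
module Conjugate {v : ℕ} (A T P : SqMat v) (P-invertible : Invertible P) (AP≡PT : A ⊗ P ≡ P ⊗ T) where

  private
    P⁻¹ = proj₁ P-invertible

    φ ψ : F2 v → F2 v
    φ x = x · P
    ψ y = y · P⁻¹

    ψφ : ∀ x → ψ (φ x) ≡ x
    ψφ x = trans (sym (·-⊗ x P P⁻¹)) (trans (cong (x ·_) (proj₁ (proj₂ P-invertible))) (·-Id x))

    φψ : ∀ y → φ (ψ y) ≡ y
    φψ y = trans (sym (·-⊗ y P⁻¹ P)) (trans (cong (y ·_) (proj₂ (proj₂ P-invertible))) (·-Id y))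

    φ-injective : ∀ {x y} → φ x ≡ φ y → x ≡ y
    φ-injective {x} {y} e = trans (sym (ψφ x)) (trans (cong ψ e) (ψφ y))

    φ-intertwines : ∀ x → φ (x · A) ≡ φ x · T
    φ-intertwines x = trans (sym (·-⊗ x A P)) (trans (cong (x ·_) AP≡PT) (·-⊗ x P T))

  count-Fixes : count v (Fixes A) ≡ count v (Fixes T)
  count-Fixes = trans (count-cong transfer) (∑-reindex φ ψ ψφ φψ (λ y → 𝟙 (Fixes T y)))
    where
    transfer : ∀ x → Fixes A x ≡ Fixes T (φ x)
    transfer x = trans (sym (eqV-injective φ φ-injective (x · A) x)) (cong (λ t → eqV t (φ x)) (φ-intertwines x))

  count-InKerΦ₃ : count v (InKerΦ₃ A) ≡ count v (InKerΦ₃ T)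
  count-InKerΦ₃ = trans (count-cong transfer) (∑-reindex φ ψ ψφ φψ (λ y → 𝟙 (InKerΦ₃ T y)))
    where
    transfer : ∀ x → InKerΦ₃ A x ≡ InKerΦ₃ T (φ x)
    transfer x = trans (sym (eqV-injective φ φ-injective ((x · A) · A) (x ⊕ (x · A))))
      (cong₂ eqV (trans (φ-intertwines (x · A)) (cong (_· T) (φ-intertwines x)))
                 (trans (·-distrib-⊕ x (x · A) P) (cong (φ x ⊕_) (φ-intertwines x))))

double : ℕ → ℕ
double zero = zero
double (suc m) = suc (suc (double m))

avf-entry : ℕ → ℕ → ℕ → Bool
avf-entry n i j =
  if (i <ᵇ n) ∧ (j <ᵇ n)
    then ((i / 2) ≡ᵇ (j / 2)) ∧ not (((i % 2) ≡ᵇ 0) ∧ ((j % 2) ≡ᵇ 0))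
    else (if (i <ᵇ n) ∨ (j <ᵇ n) then false else (i ≡ᵇ j))

-- A_{2m+f,f} in dimension double m + f, where its 2 × 2 blocks peel off by recursion on m.
Avf′ : ∀ m f → SqMat (double m + f)
Avf′ m f = Vec.tabulate λ i → Vec.tabulate λ j → avf-entry (double m) (toℕ i) (toℕ j)

Avf≡Avf′ : ∀ m f → Avf (double m + f) f ≡ Avf′ m f
Avf≡Avf′ m f =
  cong (λ n → Vec.tabulate λ i → Vec.tabulate λ j → avf-entry n (toℕ i) (toℕ j)) (m+n∸n≡m (double m) f)

private
  [2+i]/2 : ∀ i → suc (suc i) / 2 ≡ suc (i / 2)
  [2+i]/2 i = m/n≡1+[m∸n]/n {suc (suc i)} {2} (s≤s (s≤s z≤n))

  [2+i]%2 : ∀ i → suc (suc i) % 2 ≡ i % 2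
  [2+i]%2 i = trans (cong (_% 2) (+-comm 2 i)) ([m+n]%n≡m%n i 2)

avf-entry-shift : ∀ d i j → avf-entry (suc (suc d)) (suc (suc i)) (suc (suc j)) ≡ avf-entry d i j
avf-entry-shift d i j rewrite [2+i]/2 i | [2+i]/2 j | [2+i]%2 i | [2+i]%2 j = refl

avf-entry-off-first-block : ∀ d k →
  (avf-entry (suc (suc d)) 0 (suc (suc k)) ≡ false) × (avf-entry (suc (suc d)) 1 (suc (suc k)) ≡ false) ×
  (avf-entry (suc (suc d)) (suc (suc k)) 0 ≡ false) × (avf-entry (suc (suc d)) (suc (suc k)) 1 ≡ false)
avf-entry-off-first-block d k rewrite [2+i]/2 k with k <ᵇ d
... | true = refl , refl , refl , refl
... | false = refl , refl , refl , refl

tabulate-false : ∀ n (g : Fin n → Bool) → (∀ j → g j ≡ false) → Vec.tabulate g ≡ zeroV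
tabulate-false zero g _ = refl
tabulate-false (suc n) g g≡false =
  cong₂ _∷_ (g≡false Fin.zero) (tabulate-false n _ (λ j → g≡false (Fin.suc j)))
  where import Data.Fin as Fin

Avf′-suc : ∀ m f → Avf′ (suc m) f ≡ (false ∷ true ∷ zeroV) ∷ (true ∷ true ∷ zeroV) ∷
                                    Vec.map (λ r → false ∷ false ∷ r) (Avf′ m f)
Avf′-suc m f = cong₂ _∷_
  (cong (λ r → false ∷ true ∷ r) (tabulate-false _ _ (λ j → proj₁ (off (toℕ j)))))
  (cong₂ _∷_ (cong (λ r → true ∷ true ∷ r) (tabulate-false _ _ (λ j → proj₁ (proj₂ (off (toℕ j))))))
  (trans (Vecₚ.tabulate-cong (λ i → cong₂ _∷_ (proj₁ (proj₂ (proj₂ (off (toℕ i)))))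
                                      (cong₂ _∷_ (proj₂ (proj₂ (proj₂ (off (toℕ i)))))
                                                 (Vecₚ.tabulate-cong (λ j → avf-entry-shift (double m) (toℕ i) (toℕ j))))))
         (Vecₚ.tabulate-∘ (λ r → false ∷ false ∷ r) _)))
  where off = avf-entry-off-first-block (double m)

·-map-false∷false∷ : ∀ {k n} (x : F2 k) (M : Mat k n) →
                     x · Vec.map (λ r → false ∷ false ∷ r) M ≡ false ∷ false ∷ (x · M)
·-map-false∷false∷ [] [] = refl
·-map-false∷false∷ (false ∷ x) (r ∷ M) = ·-map-false∷false∷ x M
·-map-false∷false∷ (true ∷ x) (r ∷ M) = cong ((false ∷ false ∷ r) ⊕_) (·-map-false∷false∷ x M)

·-Avf′-suc : ∀ m f a b (x : F2 (double m + f)) → (a ∷ b ∷ x) · Avf′ (suc m) f ≡ b ∷ (a xor b) ∷ (x · Avf′ m f)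
·-Avf′-suc m f a b x = trans (cong ((a ∷ b ∷ x) ·_) (Avf′-suc m f)) (by-cases a b)
  where
  rest = ·-map-false∷false∷ x (Avf′ m f)
  by-cases : ∀ a b → (a ∷ b ∷ x) · ((false ∷ true ∷ zeroV) ∷ (true ∷ true ∷ zeroV) ∷
                                     Vec.map (λ r → false ∷ false ∷ r) (Avf′ m f))
                     ≡ b ∷ (a xor b) ∷ (x · Avf′ m f)
  by-cases false false = rest
  by-cases true false = trans (cong ((false ∷ true ∷ zeroV) ⊕_) rest) (cong (λ t → false ∷ true ∷ t) (⊕-identityˡ _))
  by-cases false true = trans (cong ((true ∷ true ∷ zeroV) ⊕_) rest) (cong (λ t → true ∷ true ∷ t) (⊕-identityˡ _))
  by-cases true true = trans (cong (λ t → (false ∷ true ∷ zeroV) ⊕ ((true ∷ true ∷ zeroV) ⊕ t)) rest)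
                             (cong (λ t → true ∷ false ∷ t) (trans (⊕-identityˡ _) (⊕-identityˡ _)))

Fixes-Avf′-suc : ∀ m f a b x → Fixes (Avf′ (suc m) f) (a ∷ b ∷ x) ≡ (not a ∧ not b) ∧ Fixes (Avf′ m f) x
Fixes-Avf′-suc m f a b x rewrite ·-Avf′-suc m f a b x with a | b
... | false | false = refl
... | false | true = refl
... | true | false = refl
... | true | true = refl

InKerΦ₃-Avf′-suc : ∀ m f a b x → InKerΦ₃ (Avf′ (suc m) f) (a ∷ b ∷ x) ≡ InKerΦ₃ (Avf′ m f) x
InKerΦ₃-Avf′-suc m f a b x
  rewrite ·-Avf′-suc m f a b x | ·-Avf′-suc m f b (a xor b) (x · Avf′ m f) with a | b
... | false | false = refl
... | false | true = refl
... | true | false = refl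
... | true | true = refl

count-Fixes-Avf′ : ∀ m f → count (double m + f) (Fixes (Avf′ m f)) ≡ 2 ^ f
count-Fixes-Avf′ zero f = trans (count-cong {f} (λ x → eqV-complete (·-Id x))) (∑-one f)
count-Fixes-Avf′ (suc m) f = begin
  (c false false + c false true) + (c true false + c true true)
    ≡⟨ cong₂ _+_ (cong₂ _+_ (trans (count-cong (Fixes-Avf′-suc m f false false)) (count-Fixes-Avf′ m f))
                            (moved false true refl))
                 (cong₂ _+_ (moved true false refl) (moved true true refl)) ⟩
  (2 ^ f + 0) + 0
    ≡⟨ trans (+-identityʳ _) (+-identityʳ _) ⟩
  2 ^ f
    ∎
  where
  open ≡-Reasoning
  n = double m + f
  c : Bool → Bool → ℕ
  c a b = count n (λ x → Fixes (Avf′ (suc m) f) (a ∷ b ∷ x))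
  moved : ∀ a b → not a ∧ not b ≡ false → c a b ≡ 0
  moved a b ab≢00 = count-none {n} (λ x → trans (Fixes-Avf′-suc m f a b x) (cong (_∧ _) ab≢00))

count-InKerΦ₃-Avf′ : ∀ m f → count (double m + f) (InKerΦ₃ (Avf′ m f)) ≡ 4 ^ m
count-InKerΦ₃-Avf′ zero f = trans (count-cong {f} only-zero) (count-singleton (zeroV {f}))
  where
  only-zero : ∀ x → InKerΦ₃ Id x ≡ eqV x zeroV
  only-zero x = cong₂ eqV (trans (cong (_· Id) (·-Id x)) (·-Id x)) (trans (cong (x ⊕_) (·-Id x)) (⊕-self x))
count-InKerΦ₃-Avf′ (suc m) f = begin
  (c false false + c false true) + (c true false + c true true)
    ≡⟨ cong₂ _+_ (cong₂ _+_ (step false false) (step false true)) (cong₂ _+_ (step true false) (step true true)) ⟩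
  (4 ^ m + 4 ^ m) + (4 ^ m + 4 ^ m)
    ≡⟨ solve-∀′ (4 ^ m) ⟩
  4 * 4 ^ m
    ∎
  where
  open ≡-Reasoning
  n = double m + f
  c : Bool → Bool → ℕ
  c a b = count n (λ x → InKerΦ₃ (Avf′ (suc m) f) (a ∷ b ∷ x))
  step : ∀ a b → c a b ≡ 4 ^ m
  step a b = trans (count-cong (InKerΦ₃-Avf′-suc m f a b)) (count-InKerΦ₃-Avf′ m f)
  solve-∀′ : ∀ x → (x + x) + (x + x) ≡ 4 * x
  solve-∀′ = solve-∀

count-Fixes-of-type : ∀ m f (A : SqMat (double m + f)) → HasType A f → count (double m + f) (Fixes A) ≡ 2 ^ f
count-Fixes-of-type m f A (P , P-invertible , AP≡PAvf) = trans
  (Conjugate.count-Fixes A (Avf′ m f) P P-invertible (trans AP≡PAvf (cong (P ⊗_) (Avf≡Avf′ m f))))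
  (count-Fixes-Avf′ m f)

count-InKerΦ₃-of-type : ∀ m f (A : SqMat (double m + f)) → HasType A f → count (double m + f) (InKerΦ₃ A) ≡ 4 ^ m
count-InKerΦ₃-of-type m f A (P , P-invertible , AP≡PAvf) = trans
  (Conjugate.count-InKerΦ₃ A (Avf′ m f) P P-invertible (trans AP≡PAvf (cong (P ⊗_) (Avf≡Avf′ m f))))
  (count-InKerΦ₃-Avf′ m f)

-- Arithmetic

double≡2* : ∀ m → double m ≡ 2 * m
double≡2* zero = refl
double≡2* (suc m) = trans (cong (λ t → suc (suc t)) (double≡2* m)) (sym (*-suc 2 m))

2^double : ∀ k → 2 ^ double k ≡ 4 ^ k
2^double zero = refl
2^double (suc k) = trans (sym (*-assoc 2 2 (2 ^ double k))) (cong (4 *_) (2^double k))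

even⊎odd : ∀ n → (Σ ℕ λ k → n ≡ double k) ⊎ (Σ ℕ λ k → n ≡ suc (double k))
even⊎odd zero = inj₁ (0 , refl)
even⊎odd (suc zero) = inj₂ (0 , refl)
even⊎odd (suc (suc n)) with even⊎odd n
... | inj₁ (k , n≡2k) = inj₁ (suc k , cong (λ t → suc (suc t)) n≡2k)
... | inj₂ (k , n≡2k+1) = inj₂ (suc k , cong (λ t → suc (suc t)) n≡2k+1)

geom : ℕ → ℕ
geom zero = 0
geom (suc m) = suc (4 * geom m)

4^≡1+geom*3 : ∀ m → 4 ^ m ≡ 1 + geom m * 3
4^≡1+geom*3 zero = refl
4^≡1+geom*3 (suc m) = trans (cong (4 *_) (4^≡1+geom*3 m)) (step (geom m))
  where
  step : ∀ g → 4 * (1 + g * 3) ≡ 1 + suc (4 * g) * 3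
  step = solve-∀

4^%3 : ∀ m → 4 ^ m % 3 ≡ 1
4^%3 m = trans (cong (_% 3) (4^≡1+geom*3 m)) ([m+kn]%n≡m%n 1 (geom m) 3)

geom%3 : ∀ m → geom m % 3 ≡ m % 3
geom%3 zero = refl
geom%3 (suc m) = begin
  suc (4 * geom m) % 3                  ≡⟨ cong (_% 3) (step (geom m)) ⟩
  (suc (geom m) + geom m * 3) % 3       ≡⟨ [m+kn]%n≡m%n (suc (geom m)) (geom m) 3 ⟩
  (1 + geom m) % 3                      ≡⟨ %-distribˡ-+ 1 (geom m) 3 ⟩
  (1 + geom m % 3) % 3                  ≡⟨ cong (λ r → (1 + r) % 3) (geom%3 m) ⟩
  (1 + m % 3) % 3                       ≡⟨ %-distribˡ-+ 1 m 3 ⟨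
  suc m % 3                             ∎
  where
  open ≡-Reasoning
  step : ∀ g → suc (4 * g) ≡ suc g + g * 3
  step = solve-∀

3-prime : Prime 3
3-prime = from-yes (prime? 3)

3∤2^ : ∀ f → ¬ (3 ∣ 2 ^ f)
3∤2^ zero 3∣1 with ∣⇒≤ 3∣1
... | s≤s ()
3∤2^ (suc f) 3∣2^[1+f] with euclidsLemma 2 (2 ^ f) 3-prime 3∣2^[1+f]
... | inj₁ 3∣2 with ∣⇒≤ 3∣2
...   | s≤s (s≤s ())
3∤2^ (suc f) _ | inj₂ 3∣2^f = 3∤2^ f 3∣2^f

2^%3 : ∀ m f → 2 ^ (double m + f) % 3 ≡ 2 ^ f % 3
2^%3 m f = begin
  2 ^ (double m + f) % 3                ≡⟨ cong (_% 3) (^-distribˡ-+-* 2 (double m) f) ⟩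
  (2 ^ double m * 2 ^ f) % 3            ≡⟨ cong (λ t → (t * 2 ^ f) % 3) (2^double m) ⟩
  (4 ^ m * 2 ^ f) % 3                   ≡⟨ %-distribˡ-* (4 ^ m) (2 ^ f) 3 ⟩
  ((4 ^ m % 3) * (2 ^ f % 3)) % 3       ≡⟨ cong (λ r → (r * (2 ^ f % 3)) % 3) (4^%3 m) ⟩
  (1 * (2 ^ f % 3)) % 3                 ≡⟨ cong (_% 3) (*-identityˡ (2 ^ f % 3)) ⟩
  2 ^ f % 3 % 3                         ≡⟨ m%n%n≡m%n (2 ^ f) 3 ⟩
  2 ^ f % 3                             ∎
  where open ≡-Reasoning

3∣∸2⇒%3≡2 : ∀ x → 2 ≤ x → 3 ∣ x ∸ 2 → x % 3 ≡ 2
3∣∸2⇒%3≡2 x 2≤x (divides q x∸2≡q*3) = begin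
  x % 3                  ≡⟨ cong (_% 3) (m∸n+n≡m 2≤x) ⟨
  (x ∸ 2 + 2) % 3        ≡⟨ cong (λ t → (t + 2) % 3) x∸2≡q*3 ⟩
  (q * 3 + 2) % 3        ≡⟨ cong (_% 3) (+-comm (q * 3) 2) ⟩
  (2 + q * 3) % 3        ≡⟨ [m+kn]%n≡m%n 2 q 3 ⟩
  2                      ∎
  where open ≡-Reasoning

odd-exponent : ∀ m f → 0 < double m + f → 3 ∣ 2 ^ (double m + f) ∸ 2 → Σ ℕ λ j → f ≡ suc (double j)
odd-exponent m f 0<v 3∣2^v∸2 with even⊎odd f
... | inj₂ odd = odd
... | inj₁ (j , refl) with trans (sym (3∣∸2⇒%3≡2 _ (^-monoʳ-≤ 2 0<v) 3∣2^v∸2))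
                               (trans (2^%3 m (double j)) (trans (cong (_% 3) (2^double j)) (4^%3 j)))
...   | ()

3∣geom*2^⇒3∣ : ∀ m f → 3 ∣ geom m * 2 ^ f → 3 ∣ m
3∣geom*2^⇒3∣ m f 3∣g*2^f with euclidsLemma (geom m) (2 ^ f) 3-prime 3∣g*2^f
... | inj₁ 3∣g = m%n≡0⇒n∣m m 3 (trans (sym (geom%3 m)) (n∣m⇒m%n≡0 (geom m) 3 3∣g))
... | inj₂ 3∣2^f = ⊥-elim (3∤2^ f 3∣2^f)

-- N = 2 ^ f (4 ^ m - 1) = 3 · geom m · 2 ^ f.
18∣⇒3∣ : ∀ m f N → 18 ∣ N → N + 2 ^ f ≡ 4 ^ m * 2 ^ f → 3 ∣ m
18∣⇒3∣ m f N 18∣N N+2^f≡ = 3∣geom*2^⇒3∣ m f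
  (∣-trans {3} {6} (divides 2 refl) (*-cancelˡ-∣ {6} {geom m * 2 ^ f} 3 (subst (18 ∣_) N≡ 18∣N)))
  where
  expand : ∀ g p → (1 + g * 3) * p ≡ 3 * (g * p) + p
  expand = solve-∀

  N≡ : N ≡ 3 * (geom m * 2 ^ f)
  N≡ = +-cancelʳ-≡ (2 ^ f) N (3 * (geom m * 2 ^ f)) (begin
    N + 2 ^ f                          ≡⟨ N+2^f≡ ⟩
    4 ^ m * 2 ^ f                      ≡⟨ cong (_* 2 ^ f) (4^≡1+geom*3 m) ⟩
    (1 + geom m * 3) * 2 ^ f           ≡⟨ expand (geom m) (2 ^ f) ⟩
    3 * (geom m * 2 ^ f) + 2 ^ f       ∎)
    where open ≡-Reasoning

[double-m+f]%3≡f%3 : ∀ m f → 3 ∣ m → (double m + f) % 3 ≡ f % 3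
[double-m+f]%3≡f%3 .(k * 3) f (divides k refl) = begin
  (double (k * 3) + f) % 3     ≡⟨ cong (λ t → (t + f) % 3) (double≡2* (k * 3)) ⟩
  (2 * (k * 3) + f) % 3        ≡⟨ cong (_% 3) (rearrange k f) ⟩
  (f + (2 * k) * 3) % 3        ≡⟨ [m+kn]%n≡m%n f (2 * k) 3 ⟩
  f % 3                        ∎
  where
  open ≡-Reasoning
  rearrange : ∀ k f → 2 * (k * 3) + f ≡ f + (2 * k) * 3
  rearrange = solve-∀

double-mono : ∀ {a b} → a ≤ b → double a ≤ double b
double-mono {a} {b} a≤b = subst₂ _≤_ (sym (double≡2* a)) (sym (double≡2* b)) (*-monoʳ-≤ 2 a≤b)

m≤1+j : ∀ m j → double m + suc (double j) < 2 * suc (double j) + 3 → m ≤ suc j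
m≤1+j m j v<2f+3 with m ≤? suc j
... | yes m≤1+j = m≤1+j
... | no m≰1+j = ⊥-elim (<⇒≱ v<2f+3 (begin
  2 * suc (double j) + 3                  ≡⟨ lhs≡ (double j) ⟩
  double (suc (suc j)) + suc (double j)   ≤⟨ +-monoˡ-≤ _ (double-mono (≰⇒> m≰1+j)) ⟩
  double m + suc (double j)               ∎))
  where
  open ≤-Reasoning
  lhs≡ : ∀ d → 2 * suc d + 3 ≡ suc (suc (suc (suc d))) + suc d
  lhs≡ = solve-∀

4^≤1⇒≡0 : ∀ j → 4 ^ j ≤ 1 → j ≡ 0
4^≤1⇒≡0 zero _ = refl
4^≤1⇒≡0 (suc j) 4^j≤1 = ⊥-elim (<⇒≱ (s≤s (s≤s z≤n)) (≤-trans (*-monoʳ-≤ 4 (m^n>0 4 j)) 4^j≤1))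

-- With f = 2 j + 1 and 2 m < f + 3 one gets 3 (2 · 4 ^ j - 1) ≤ 4 ^ m - 1 ≤ 4 ^ (j + 1) - 1,
-- which forces j = 0 and m ≤ 1.
dimension≤3 : ∀ m f j W U → f ≡ suc (double j) → double m + f < 2 * f + 3 →
              W + 1 ≡ 2 ^ f → U + 1 ≡ 4 ^ m → 3 * W ≤ U → double m + f ≤ 3
dimension≤3 m .(suc (double j)) j W U refl v<2f+3 W+1≡ U+1≡ 3W≤U
  with 4^≤1⇒≡0 j (*-cancelˡ-≤ 2 (+-cancelˡ-≤ (4 * 4 ^ j) (2 * 4 ^ j) 2 6X≤4X+2))
  where
  X = 4 ^ j
  6X≤4X+2 : 4 * X + 2 * X ≤ 4 * X + 2
  6X≤4X+2 = begin
    4 * X + 2 * X              ≡⟨ regroup X ⟩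
    3 * (2 * X)                ≡⟨ cong (3 *_) (trans (cong (2 *_) (sym (2^double j))) (sym W+1≡)) ⟩
    3 * (W + 1)                ≡⟨ *-distribˡ-+ 3 W 1 ⟩
    3 * W + 3                  ≤⟨ +-monoˡ-≤ 3 3W≤U ⟩
    U + 3                      ≡⟨ +-assoc U 1 2 ⟨
    U + 1 + 2                  ≡⟨ cong (_+ 2) U+1≡ ⟩
    4 ^ m + 2                  ≤⟨ +-monoˡ-≤ 2 (^-monoʳ-≤ 4 (m≤1+j m j v<2f+3)) ⟩
    4 * X + 2                  ∎
    where
    open ≤-Reasoning
    regroup : ∀ x → 4 * x + 2 * x ≡ 3 * (2 * x)
    regroup = solve-∀
... | refl = +-monoˡ-≤ 1 (double-mono (m≤1+j m 0 v<2f+3))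

nonzero-vector : ∀ n → 0 < n → Σ (F2 n) λ x → x ≢ zeroV
nonzero-vector (suc n) _ = true ∷ zeroV , λ ()

even-difference : ∀ {v f} → f ≤ v → (v ∸ f) % 2 ≡ 0 → Σ ℕ λ m → v ≡ double m + f
even-difference {v} {f} f≤v [v∸f]%2≡0 with even⊎odd (v ∸ f)
... | inj₁ (m , v∸f≡2m) = m , trans (sym (m∸n+n≡m f≤v)) (cong (_+ f) v∸f≡2m)
... | inj₂ (k , v∸f≡2k+1) with trans (sym [v∸f]%2≡0) (trans (cong (_% 2) v∸f≡2k+1) odd%2)
  where
  odd%2 : suc (double k) % 2 ≡ 1
  odd%2 = trans (cong (λ t → suc t % 2) (trans (double≡2* k) (*-comm 2 k))) ([m+kn]%n≡m%n 1 k 2)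
... | ()

no-automorphism : ∀ m f → 7 ≤ double m + f → double m + f < 2 * f + 3 → f % 3 ≢ (double m + f) % 3 →
                  (D : Sub (double m + f) → Bool) → IsSTS2 (double m + f) D →
                  (A : SqMat (double m + f)) → IsAutomorphism D A → HasOrder3 A → HasType A f → ⊥
no-automorphism m f 7≤v v<2f+3 f%3≢v%3 D sts A (_ , D-invariant) (A³≡Id , _) type =
  <⇒≱ (s≤s (s≤s (s≤s (s≤s z≤n)))) (≤-trans 7≤v v≤3)
  where
  v = double m + f
  open STS D sts
  open Automorphism D sts A A³≡Id D-invariant

  0<v : 0 < v
  0<v = ≤-trans (s≤s z≤n) 7≤v

  f-odd : Σ ℕ λ j → f ≡ suc (double j)
  f-odd = odd-exponent m f 0<v (∣-trans (divides 2 refl) (sts-order w (proj₂ (nonzero-vector v 0<v))))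
    where w = proj₁ (nonzero-vector v 0<v)

  #moved : count v Moved + 2 ^ f ≡ 4 ^ m * 2 ^ f
  #moved = begin
    count v Moved + 2 ^ f                ≡⟨ cong (count v Moved +_) (count-Fixes-of-type m f A type) ⟨
    count v Moved + count v (Fixes A)    ≡⟨ count-Moved+Fixes ⟩
    2 ^ (double m + f)                   ≡⟨ ^-distribˡ-+-* 2 (double m) f ⟩
    2 ^ double m * 2 ^ f                 ≡⟨ cong (_* 2 ^ f) (2^double m) ⟩
    4 ^ m * 2 ^ f                        ∎
    where open ≡-Reasoning

  18∤moved : ¬ (18 ∣ count v Moved)
  18∤moved 18∣ = f%3≢v%3 (sym ([double-m+f]%3≡f%3 m f (18∣⇒3∣ m f _ 18∣ #moved)))

  v≤3 : v ≤ 3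
  v≤3 = dimension≤3 m f (proj₁ f-odd) _ _ (proj₂ f-odd) v<2f+3
          (trans count-NonzeroFixed (count-Fixes-of-type m f A type))
          (trans count-NonzeroInU (count-InKerΦ₃-of-type m f A type))
          (invariant-blocks⇒3W≤U (18∤moved⇒invariant-blocks 18∤moved))

lemma8 : (v f : ℕ) → 7 ≤ v → f < v → (v ∸ f) % 2 ≡ 0 →
         v < 2 * f + 3 → f % 3 ≢ v % 3 →
         (D : Sub v → Bool) → IsSTS2 v D →
         (A : SqMat v) → IsAutomorphism D A → HasOrder3 A → HasType A f → ⊥
lemma8 v f 7≤v f<v [v∸f]%2≡0 with even-difference (<⇒≤ f<v) [v∸f]%2≡0
... | m , refl = no-automorphism m f 7≤v
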